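{- Let $\rho(n)$ denote the Abelian complexity of the Tribonacci word $\mathbf{t}$. Then $\rho(n)\in\{3,4,5,6,7\}$ for every positive integer $n$, and each of the five values $3,4,5,6,7$ is attained, i.e. for each $m\in\{3,4,5,6,7\}$ there exists $n\ge1$ with $\rho(n)=m$.
   Context: Let $\tau$ be the morphism on $\{0,1,2\}^*$ given by $0\mapsto 01$, $1\mapsto 02$, $2\mapsto 0$, and let $\mathbf{t}=\lim_{n\to\infty}\tau^n(0)$ be its fixed point (the Tribonacci word). A factor of an infinite word is a finite block of consecutive letters. Two finite words $u,v$ are Abelian equivalent if $|u|_a=|v|_a$ for every letter $a$ (where $|u|_a$ is the number of occurrences of $a$ in $u$). The Abelian complexity $\rho(n)$ is the number of Abelian equivalence classes among the factors of $\mathbf{t}$ of length $n$, equivalently the number of distinct Parikh vectors $(|u|_0,|u|_1,|u|_2)$ of factors $u$ of $\mathbf{t}$ of length $n$. -}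

module Defs where

open import Data.Nat using (ℕ; zero; suc; _+_; _≤_)
open import Data.Fin using (Fin; zero; suc)
open import Data.Fin.Properties using () renaming (_≟_ to _≟ᶠ_)
open import Data.List using (List; []; _∷_; concatMap; map; upTo; length; filter)
open import Data.List.Relation.Unary.Unique.Propositional using (Unique)
open import Data.List.Membership.Propositional using (_∈_)
open import Data.Product using (_×_; _,_; ∃-syntax)
open import Relation.Binary.PropositionalEquality using (_≡_)

Letter : Set
Letter = Fin 3

l0 l1 l2 : Letter
l0 = zero
l1 = suc zero
l2 = suc (suc zero)

τ : Letter → List Letter
τ zero = l0 ∷ l1 ∷ []
τ (suc zero) = l0 ∷ l2 ∷ []
τ (suc (suc zero)) = l0 ∷ []

τ* : List Letter → List Letter
τ* = concatMap τ

τ^ : ℕ → List Letter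
τ^ zero = l0 ∷ []
τ^ (suc k) = τ* (τ^ k)

-- Since τ^k(0) is a prefix of
-- τ^(k+1)(0) and |τ^(i+1)(0)| > i, the i-th letter of t is the i-th letter of
-- τ^(i+1)(0); the default l0 is never used.
-- i-th letter of a word, with a default when out of range
at : Letter → List Letter → ℕ → Letter
at d [] _ = d
at d (x ∷ _) zero = x
at d (_ ∷ xs) (suc i) = at d xs i

t : ℕ → Letter
t i = at l0 (τ^ (suc i)) i

factor : ℕ → ℕ → List Letter
factor i n = map (λ j → t (i + j)) (upTo n)

count : Letter → List Letter → ℕ
count a u = length (filter (λ b → b ≟ᶠ a) u)

ParikhVec : Set
ParikhVec = ℕ × ℕ × ℕ

parikh : List Letter → ParikhVec
parikh u = count l0 u , count l1 u , count l2 u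

IsParikhOfFactor : ℕ → ParikhVec → Set
IsParikhOfFactor n v = ∃[ i ] parikh (factor i n) ≡ v

AbelianComplexity : ℕ → ℕ → Set
AbelianComplexity n m =
  ∃[ vs ] (Unique vs × length vs ≡ m
          × (∀ v → v ∈ vs → IsParikhOfFactor n v)
          × (∀ i → parikh (factor i n) ∈ vs))

-- The Tribonacci word t is a fixed point of τ, so every factor of length n ≥ 1 is, up to one letter
-- at each end, the τ-image of a shorter factor. Record for the factor of length n at position i its
-- state: the letters just before and after it, and the difference between its Parikh vector and that
-- of the prefix of length n. Under desubstitution the new state is determined by the old one and by
-- the nine letters of t around position n, so a finite table of (window, state) pairs closed under
-- this step contains every state that occurs; a computation shows that it allows at most seven
-- differences per window, whence ρ(n) ≤ 7. Every Parikh vector of a factor already occurs at a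
-- position below an explicit bound, which makes the exact set of Parikh vectors computable from the
-- candidates. A second table, closed under the converse step, lists states that do occur and gives
-- three distinct differences for every n ≥ 1. The values 3, 4, 5, 6, 7 are attained at
-- n = 1, 3, 30, 2115, 3914.

module Submission where

open import Defs
open import Data.Nat using (ℕ; _≤_; _<_)
open import Data.Product using (_×_; ∃-syntax)

open import Algebra.Bundles using (CommutativeMonoid)
import Algebra.Solver.CommutativeMonoid
open import Data.Bool using (Bool; true; false; T; _∧_; _∨_; not)
open import Data.Bool.ListAction using (all; any)
open import Data.Bool.Properties using (T-∧; T-∨)
open import Data.Empty using (⊥; ⊥-elim)
open import Data.Fin using (zero; suc) renaming (_≟_ to _≟ᶠ_)
open import Data.List using (List; []; _∷_; _++_; length; map; take; drop; filter; concatMap; applyUpTo; upTo; deduplicate)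
open import Data.List.Membership.Propositional using (_∈_; find)
open import Data.List.Membership.Propositional.Properties
  using (∈-map⁺; ∈-map⁻; ∈-filter⁺; ∈-filter⁻; ∈-deduplicate⁺; ∈-deduplicate⁻; ∈-upTo⁺; ∈-upTo⁻)
open import Data.List.Properties
  using (length-++; length-map; length-drop; length-filter; length-deduplicate; length-applyUpTo; concatMap-++;
         ++-assoc; ++-identityʳ; take-all; take++drop≡id; map-upTo; map-∘; map-++)
import Data.List.Properties as List
import Data.List.Relation.Unary.All as All
open import Data.List.Relation.Unary.All using (_∷_)
open import Data.List.Relation.Unary.All.Properties using (all⁺)
open import Data.List.Relation.Unary.AllPairs using (_∷_)
open import Data.List.Relation.Binary.Pointwise using (Pointwise; _∷_)
import Data.List.Relation.Binary.Pointwise as Pointwise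
open import Data.List.Relation.Unary.Any using (here; there)
open import Data.List.Relation.Unary.Any.Properties using (any⁻)
open import Data.List.Relation.Unary.Unique.DecPropositional.Properties using (deduplicate-!)
open import Data.List.Relation.Unary.Unique.Propositional using (Unique)
open import Data.Maybe using (Maybe; just; nothing)
import Data.Maybe.Properties as Maybe
open import Data.Nat
open import Data.Nat.Induction using (<-rec)
open import Data.Nat.Properties
open import Data.Nat.Tactic.RingSolver using (solve-∀)
open import Data.Product using (Σ-syntax; _×_; _,_; ∃-syntax; proj₁; proj₂; uncurry)
import Data.Product.Properties as Product
open import Data.Sum using (inj₁; inj₂; [_,_]′)
open import Data.Unit using (⊤; tt)
open import Function using (_∘_; Equivalence)
open import Level using (0ℓ)
open import Relation.Binary.Definitions using (DecidableEquality)
open import Relation.Binary.PropositionalEquality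
open import Relation.Binary.PropositionalEquality.Algebra using (isMagma)
open import Relation.Nullary using (Dec; yes; no; ¬_)
open import Relation.Nullary.Decidable using (isYes; toWitness; fromWitness; True; _×-dec_)

-- The fixed point t

lookupᵈ : {A : Set} → A → List A → ℕ → A
lookupᵈ d [] _ = d
lookupᵈ d (x ∷ _) zero = x
lookupᵈ d (_ ∷ xs) (suc i) = lookupᵈ d xs i

at≡lookupᵈ : ∀ d (u : List Letter) i → at d u i ≡ lookupᵈ d u i
at≡lookupᵈ d [] i = refl
at≡lookupᵈ d (x ∷ u) zero = refl
at≡lookupᵈ d (x ∷ u) (suc i) = at≡lookupᵈ d u i

module _ {A : Set} (d : A) where

  lookupᵈ-++ˡ : ∀ (u v : List A) {i} → i < length u → lookupᵈ d (u ++ v) i ≡ lookupᵈ d u i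
  lookupᵈ-++ˡ (x ∷ u) v {zero} _ = refl
  lookupᵈ-++ˡ (x ∷ u) v {suc i} (s≤s i<) = lookupᵈ-++ˡ u v i<

  lookupᵈ-++ʳ : ∀ (u v : List A) i → lookupᵈ d (u ++ v) (length u + i) ≡ lookupᵈ d v i
  lookupᵈ-++ʳ [] v i = refl
  lookupᵈ-++ʳ (x ∷ u) v i = lookupᵈ-++ʳ u v i

  take-suc-lookupᵈ : ∀ (u : List A) {i} → i < length u → take (suc i) u ≡ take i u ++ lookupᵈ d u i ∷ []
  take-suc-lookupᵈ (x ∷ u) {zero} _ = refl
  take-suc-lookupᵈ (x ∷ u) {suc i} (s≤s i<) = cong (x ∷_) (take-suc-lookupᵈ u i<)

  lookupᵈ-applyUpTo : ∀ (f : ℕ → A) {n i} → i < n → lookupᵈ d (applyUpTo f n) i ≡ f i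
  lookupᵈ-applyUpTo f {suc n} {zero} _ = refl
  lookupᵈ-applyUpTo f {suc n} {suc i} (s≤s i<) = lookupᵈ-applyUpTo (f ∘ suc) i<

applyUpTo-cong : ∀ {A : Set} {f g : ℕ → A} → (∀ j → f j ≡ g j) → ∀ n → applyUpTo f n ≡ applyUpTo g n
applyUpTo-cong f≗g zero = refl
applyUpTo-cong f≗g (suc n) = cong₂ _∷_ (f≗g 0) (applyUpTo-cong (f≗g ∘ suc) n)

lookupᵈ-map : ∀ {A B : Set} (f : A → B) d d' (u : List A) {i} → i < length u →
              lookupᵈ d' (map f u) i ≡ f (lookupᵈ d u i)
lookupᵈ-map f d d' (x ∷ u) {zero} _ = refl
lookupᵈ-map f d d' (x ∷ u) {suc i} (s≤s i<) = lookupᵈ-map f d d' u i<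

τ*-++ : ∀ u v → τ* (u ++ v) ≡ τ* u ++ τ* v
τ*-++ = concatMap-++ τ

τ^-suc-extends : ∀ k → ∃[ s ] τ^ (suc k) ≡ τ^ k ++ s
τ^-suc-extends zero = l1 ∷ [] , refl
τ^-suc-extends (suc k) =
  let s , eq = τ^-suc-extends k in τ* s , trans (cong τ* eq) (τ*-++ (τ^ k) s)

τ^-extends : ∀ {a b} → a ≤′ b → ∃[ s ] τ^ b ≡ τ^ a ++ s
τ^-extends ≤′-refl = [] , sym (++-identityʳ _)
τ^-extends (≤′-step {n} a≤n) =
  let s , eq = τ^-extends a≤n ; s' , eq' = τ^-suc-extends n
  in s ++ s' , trans eq' (trans (cong (_++ s') eq) (++-assoc _ s s'))

length-≤-τ* : ∀ w → length w ≤ length (τ* w)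
length-≤-τ* [] = z≤n
length-≤-τ* (zero ∷ w) = m≤n⇒m≤1+n (s≤s (length-≤-τ* w))
length-≤-τ* (suc zero ∷ w) = m≤n⇒m≤1+n (s≤s (length-≤-τ* w))
length-≤-τ* (suc (suc zero) ∷ w) = s≤s (length-≤-τ* w)

τ^-head : ∀ k → ∃[ w ] τ^ k ≡ l0 ∷ w
τ^-head zero = [] , refl
τ^-head (suc k) = let w , eq = τ^-head k in l1 ∷ τ* w , cong τ* eq

<-length-τ^ : ∀ k → k < length (τ^ k)
<-length-τ^ zero = s≤s z≤n
<-length-τ^ (suc k) =
  let w , eq = τ^-head k
  in subst (λ u → suc k < length (τ* u)) (sym eq)
       (s≤s (≤-trans (subst (λ u → k < length u) eq (<-length-τ^ k)) (s≤s (length-≤-τ* w))))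

t-τ^ : ∀ K {x} → x < length (τ^ K) → t x ≡ lookupᵈ l0 (τ^ K) x
t-τ^ K {x} x< with ≤-total K (suc x)
... | inj₁ K≤ =
  let s , eq = τ^-extends (≤⇒≤′ K≤)
  in trans (at≡lookupᵈ l0 (τ^ (suc x)) x) (trans (cong (λ u → lookupᵈ l0 u x) eq) (lookupᵈ-++ˡ l0 (τ^ K) s x<))
... | inj₂ K≥ =
  let s , eq = τ^-extends (≤⇒≤′ K≥)
  in trans (at≡lookupᵈ l0 (τ^ (suc x)) x) (sym (trans (cong (λ u → lookupᵈ l0 u x) eq)
       (lookupᵈ-++ˡ l0 (τ^ (suc x)) s (<-trans (n<1+n x) (<-length-τ^ (suc x))))))

lookupᵈ-τ* : ∀ d (w : List Letter) {k b} → k < length w → b < length (τ (lookupᵈ d w k)) →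
  lookupᵈ d (τ* w) (length (τ* (take k w)) + b) ≡ lookupᵈ d (τ (lookupᵈ d w k)) b
lookupᵈ-τ* d (x ∷ w) {zero} _ b< = lookupᵈ-++ˡ d (τ x) (τ* w) b<
lookupᵈ-τ* d (x ∷ w) {suc k} {b} (s≤s k<) b<
  rewrite length-++ (τ x) {τ* (take k w)} | +-assoc (length (τ x)) (length (τ* (take k w))) b
  = trans (lookupᵈ-++ʳ d (τ x) (τ* w) _) (lookupᵈ-τ* d w k< b<)

length-τ*-take : ∀ w k → length (τ* (take k w)) ≤ length (τ* w)
length-τ*-take w k = subst (length (τ* (take k w)) ≤_) split (m≤m+n _ _)
  where
  split : length (τ* (take k w)) + length (τ* (drop k w)) ≡ length (τ* w)
  split = trans (sym (length-++ (τ* (take k w))))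
            (cong length (trans (sym (τ*-++ (take k w) (drop k w))) (cong τ* (take++drop≡id k w))))

tBlockPos : ℕ → ℕ
tBlockPos zero = 0
tBlockPos (suc k) = tBlockPos k + length (τ (t k))

tBlockPos-τ^ : ∀ K {k} → k ≤ length (τ^ K) → tBlockPos k ≡ length (τ* (take k (τ^ K)))
tBlockPos-τ^ K {zero} _ = refl
tBlockPos-τ^ K {suc k} k< =
  begin
    tBlockPos k + length (τ (t k))
      ≡⟨ cong₂ (λ p x → p + length (τ x)) (tBlockPos-τ^ K (<⇒≤ k<)) (t-τ^ K {k} k<) ⟩
    length (τ* (take k (τ^ K))) + length (τ (lookupᵈ l0 (τ^ K) k))
      ≡⟨ cong (λ u → length (τ* (take k (τ^ K))) + length u) (sym (++-identityʳ (τ (lookupᵈ l0 (τ^ K) k)))) ⟩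
    length (τ* (take k (τ^ K))) + length (τ (lookupᵈ l0 (τ^ K) k) ++ [])
      ≡⟨ sym (length-++ (τ* (take k (τ^ K)))) ⟩
    length (τ* (take k (τ^ K)) ++ τ* (lookupᵈ l0 (τ^ K) k ∷ []))
      ≡⟨ cong length (sym (τ*-++ (take k (τ^ K)) _)) ⟩
    length (τ* (take k (τ^ K) ++ lookupᵈ l0 (τ^ K) k ∷ []))
      ≡⟨ cong (length ∘ τ*) (sym (take-suc-lookupᵈ l0 (τ^ K) k<)) ⟩
    length (τ* (take (suc k) (τ^ K))) ∎
  where open ≡-Reasoning

t-block : ∀ k {b} → b < length (τ (t k)) → t (tBlockPos k + b) ≡ lookupᵈ l0 (τ (t k)) b
t-block k {b} b< =
  begin
    t (tBlockPos k + b)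
      ≡⟨ t-τ^ (suc K) inside ⟩
    lookupᵈ l0 (τ* (τ^ K)) (tBlockPos k + b)
      ≡⟨ cong (λ p → lookupᵈ l0 (τ* (τ^ K)) (p + b)) (tBlockPos-τ^ K (<⇒≤ k<)) ⟩
    lookupᵈ l0 (τ* (τ^ K)) (length (τ* (take k (τ^ K))) + b)
      ≡⟨ lookupᵈ-τ* l0 (τ^ K) k< (subst (λ x → b < length (τ x)) tk b<) ⟩
    lookupᵈ l0 (τ (lookupᵈ l0 (τ^ K) k)) b
      ≡⟨ cong (λ x → lookupᵈ l0 (τ x) b) (sym tk) ⟩
    lookupᵈ l0 (τ (t k)) b ∎
  where
  open ≡-Reasoning
  K = suc k
  k< : k < length (τ^ K)
  k< = <-trans (n<1+n k) (<-length-τ^ K)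
  tk : t k ≡ lookupᵈ l0 (τ^ K) k
  tk = t-τ^ K k<
  inside : tBlockPos k + b < length (τ* (τ^ K))
  inside = ≤-trans (+-monoʳ-< (tBlockPos k) b<)
             (subst (_≤ length (τ* (τ^ K))) (sym (tBlockPos-τ^ K k<)) (length-τ*-take (τ^ K) (suc k)))

-- The padded word and its blocks

Sym : Set
Sym = Maybe Letter

pattern □ = nothing
pattern a0 = just zero
pattern a1 = just (suc zero)
pattern a2 = just (suc (suc zero))

σ : Sym → List Sym
σ (just x) = map just (τ x)
σ □ = □ ∷ []

σ* : List Sym → List Sym
σ* = concatMap σ

-- Four holes in front of t give every position of t, even near the start, a full window
-- of context; □ is fixed by σ, so the padded word is still a fixed point of σ.
padded : ℕ → Sym
padded (suc (suc (suc (suc k)))) = just (t k)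
padded _ = □

blockPos : ℕ → ℕ
blockPos zero = 0
blockPos (suc Q) = blockPos Q + length (σ (padded Q))

window : ℕ → ℕ → List Sym
window X w = applyUpTo (λ j → padded (X + j)) w

record OccursAt (L : List Sym) (X : ℕ) : Set where
  field letterAt : ∀ j → j < length L → padded (X + j) ≡ lookupᵈ □ L j
open OccursAt public

blockPos-shift : ∀ k → blockPos (4 + k) ≡ 4 + tBlockPos k
blockPos-shift zero = refl
blockPos-shift (suc k) =
  trans (cong₂ _+_ (blockPos-shift k) (length-map just (τ (t k)))) (+-assoc 4 (tBlockPos k) _)

σ-block : ∀ Q → OccursAt (σ (padded Q)) (blockPos Q)
σ-block 0 .letterAt zero _ = refl
σ-block 1 .letterAt zero _ = refl
σ-block 2 .letterAt zero _ = refl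
σ-block 3 .letterAt zero _ = refl
σ-block 0 .letterAt (suc j) (s≤s ())
σ-block 1 .letterAt (suc j) (s≤s ())
σ-block 2 .letterAt (suc j) (s≤s ())
σ-block 3 .letterAt (suc j) (s≤s ())
σ-block (suc (suc (suc (suc k)))) .letterAt j j< =
  begin
    padded (blockPos (4 + k) + j)      ≡⟨ cong (λ p → padded (p + j)) (blockPos-shift k) ⟩
    just (t (tBlockPos k + j))         ≡⟨ cong just (t-block k j<′) ⟩
    just (lookupᵈ l0 (τ (t k)) j)      ≡⟨ sym (lookupᵈ-map just l0 □ (τ (t k)) j<′) ⟩
    lookupᵈ □ (map just (τ (t k))) j ∎
  where
  open ≡-Reasoning
  j<′ : j < length (τ (t k))
  j<′ = subst (j <_) (length-map just (τ (t k))) j<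

window-occurs : ∀ X w → OccursAt (window X w) X
window-occurs X w .letterAt j j< =
  sym (lookupᵈ-applyUpTo □ (λ j → padded (X + j)) (subst (j <_) (length-applyUpTo _ w) j<))

occursAt-head : ∀ {x L X} → OccursAt (x ∷ L) X → padded X ≡ x
occursAt-head {X = X} occ = trans (cong padded (sym (+-identityʳ X))) (occ .letterAt 0 (s≤s z≤n))

occursAt-tail : ∀ {x L X} → OccursAt (x ∷ L) X → OccursAt L (suc X)
occursAt-tail {X = X} occ .letterAt j j< = trans (cong padded (sym (+-suc X j))) (occ .letterAt (suc j) (s≤s j<))

occursAt-σ* : ∀ {L X} → OccursAt L X → OccursAt (σ* L) (blockPos X)
occursAt-σ* {x ∷ L} {X} occ .letterAt j j<
  with j <? length (σ x)
... | yes j<x = trans (subst (λ s → padded (blockPos X + j) ≡ lookupᵈ □ (σ s) j) (occursAt-head occ) (σ-block X .letterAt j j<x′))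
                      (sym (lookupᵈ-++ˡ □ (σ x) (σ* L) j<x))
  where j<x′ : j < length (σ (padded X))
        j<x′ = subst (λ s → j < length (σ s)) (sym (occursAt-head occ)) j<x
... | no j≮x with o , refl ← m≤n⇒∃[o]m+o≡n (≮⇒≥ j≮x) =
  begin
    padded (blockPos X + (length (σ x) + o))
      ≡⟨ cong padded (sym (+-assoc (blockPos X) _ o)) ⟩
    padded (blockPos X + length (σ x) + o)
      ≡⟨ cong (λ s → padded (blockPos X + length (σ s) + o)) (sym (occursAt-head occ)) ⟩
    padded (blockPos (suc X) + o)
      ≡⟨ occursAt-σ* (occursAt-tail occ) .letterAt o o< ⟩
    lookupᵈ □ (σ* L) o
      ≡⟨ sym (lookupᵈ-++ʳ □ (σ x) (σ* L) o) ⟩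
    lookupᵈ □ (σ x ++ σ* L) (length (σ x) + o) ∎
  where
  open ≡-Reasoning
  o< : o < length (σ* L)
  o< = +-cancelˡ-< (length (σ x)) o _ (subst (length (σ x) + o <_) (length-++ (σ x)) j<)

occursAt-drop : ∀ {L X} q → OccursAt L X → OccursAt (drop q L) (X + q)
occursAt-drop {L} {X} zero occ = subst (OccursAt L) (sym (+-identityʳ X)) occ
occursAt-drop {x ∷ L} {X} (suc q) occ =
  subst (OccursAt (drop q L)) (sym (+-suc X q)) (occursAt-drop q (occursAt-tail occ))
occursAt-drop {[]} (suc q) occ .letterAt j ()

window-occursAt : ∀ {L X} w → OccursAt L X → w ≤ length L → window X w ≡ take w L
window-occursAt zero occ _ = refl
window-occursAt {x ∷ L} {X} (suc w) occ (s≤s w≤) =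
  cong₂ _∷_ (trans (cong padded (+-identityʳ X)) (occursAt-head occ))
    (trans (applyUpTo-cong (λ j → cong padded (+-suc X j)) w) (window-occursAt w (occursAt-tail occ) w≤))

-- Parikh vectors

infixl 6 _⊕_

_⊕_ : ParikhVec → ParikhVec → ParikhVec
(a , b , c) ⊕ (a' , b' , c') = a + a' , b + b' , c + c'

𝟘 𝟙 : ParikhVec
𝟘 = 0 , 0 , 0
𝟙 = 1 , 1 , 1

∣_∣₀ ∣_∣₁ : ParikhVec → ℕ
∣ v ∣₀ = proj₁ v
∣ v ∣₁ = proj₁ (proj₂ v)

⊕-identityˡ : ∀ u → 𝟘 ⊕ u ≡ u
⊕-identityˡ u = refl

⊕-identityʳ : ∀ u → u ⊕ 𝟘 ≡ u
⊕-identityʳ (a , b , c) = cong₂ _,_ (+-identityʳ a) (cong₂ _,_ (+-identityʳ b) (+-identityʳ c))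

⊕-assoc : ∀ u v w → (u ⊕ v) ⊕ w ≡ u ⊕ (v ⊕ w)
⊕-assoc (a , b , c) (a' , b' , c') (a'' , b'' , c'') =
  cong₂ _,_ (+-assoc a a' a'') (cong₂ _,_ (+-assoc b b' b'') (+-assoc c c' c''))

⊕-comm : ∀ u v → u ⊕ v ≡ v ⊕ u
⊕-comm (a , b , c) (a' , b' , c') = cong₂ _,_ (+-comm a a') (cong₂ _,_ (+-comm b b') (+-comm c c'))

⊕-cancelʳ : ∀ u v w → u ⊕ w ≡ v ⊕ w → u ≡ v
⊕-cancelʳ (a , b , c) (a' , b' , c') (x , y , z) eq =
  cong₂ _,_ (+-cancelʳ-≡ x a a' (cong proj₁ eq))
    (cong₂ _,_ (+-cancelʳ-≡ y b b' (cong (proj₁ ∘ proj₂) eq)) (+-cancelʳ-≡ z c c' (cong (proj₂ ∘ proj₂) eq)))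

⊕-cancelˡ : ∀ u v w → w ⊕ u ≡ w ⊕ v → u ≡ v
⊕-cancelˡ u v w eq = ⊕-cancelʳ u v w (trans (⊕-comm u w) (trans eq (⊕-comm w v)))

⊕-commutativeMonoid : CommutativeMonoid 0ℓ 0ℓ
⊕-commutativeMonoid = record
  { Carrier = ParikhVec
  ; _≈_ = _≡_
  ; _∙_ = _⊕_
  ; ε = 𝟘
  ; isCommutativeMonoid = record
    { isMonoid = record
      { isSemigroup = record { isMagma = isMagma _⊕_ ; assoc = ⊕-assoc }
      ; identity = ⊕-identityˡ , ⊕-identityʳ
      }
    ; comm = ⊕-comm
    }
  }

module ⊕-Solver = Algebra.Solver.CommutativeMonoid ⊕-commutativeMonoid

unit : Sym → ParikhVec
unit a0 = 1 , 0 , 0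
unit a1 = 0 , 1 , 0
unit a2 = 0 , 0 , 1
unit □ = 𝟘

parikhˢ : List Sym → ParikhVec
parikhˢ [] = 𝟘
parikhˢ (s ∷ u) = unit s ⊕ parikhˢ u

parikhˢ-++ : ∀ u v → parikhˢ (u ++ v) ≡ parikhˢ u ⊕ parikhˢ v
parikhˢ-++ [] v = refl
parikhˢ-++ (s ∷ u) v = trans (cong (unit s ⊕_) (parikhˢ-++ u v)) (sym (⊕-assoc (unit s) (parikhˢ u) (parikhˢ v)))

parikh-∷ : ∀ x u → parikh (x ∷ u) ≡ unit (just x) ⊕ parikh u
parikh-∷ zero u = refl
parikh-∷ (suc zero) u = refl
parikh-∷ (suc (suc zero)) u = refl

parikh≡parikhˢ : ∀ u → parikh u ≡ parikhˢ (map just u)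
parikh≡parikhˢ [] = refl
parikh≡parikhˢ (x ∷ u) = trans (parikh-∷ x u) (cong (unit (just x) ⊕_) (parikh≡parikhˢ u))

M : ParikhVec → ParikhVec
M (a , b , c) = a + b + c , a , b

M-⊕ : ∀ u v → M (u ⊕ v) ≡ M u ⊕ M v
M-⊕ (a , b , c) (a' , b' , c') = cong (_, a + a' , b + b') (lemma a b c a' b' c')
  where
  lemma : ∀ a b c a' b' c' → a + a' + (b + b') + (c + c') ≡ a + b + c + (a' + b' + c')
  lemma = solve-∀

parikhˢ-σ : ∀ s → parikhˢ (σ s) ≡ M (unit s)
parikhˢ-σ a0 = refl
parikhˢ-σ a1 = refl
parikhˢ-σ a2 = refl
parikhˢ-σ □ = refl

length-σ : ∀ s → length (σ s) ≡ 1 + ∣ unit s ∣₀ + ∣ unit s ∣₁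
length-σ a0 = refl
length-σ a1 = refl
length-σ a2 = refl
length-σ □ = refl

prefixParikh : ℕ → ParikhVec
prefixParikh zero = 𝟘
prefixParikh (suc Q) = prefixParikh Q ⊕ unit (padded Q)

prefixParikh-occurs : ∀ {L X} q → OccursAt L X → q ≤ length L →
                      prefixParikh (X + q) ≡ prefixParikh X ⊕ parikhˢ (take q L)
prefixParikh-occurs {L} {X} zero _ _ =
  trans (cong prefixParikh (+-identityʳ X)) (sym (⊕-identityʳ (prefixParikh X)))
prefixParikh-occurs {x ∷ L} {X} (suc q) occ (s≤s q≤) =
  begin
    prefixParikh (X + suc q)                              ≡⟨ cong prefixParikh (+-suc X q) ⟩
    prefixParikh (suc X + q)                              ≡⟨ prefixParikh-occurs q (occursAt-tail occ) q≤ ⟩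
    prefixParikh X ⊕ unit (padded X) ⊕ parikhˢ (take q L) ≡⟨ cong (λ s → prefixParikh X ⊕ unit s ⊕ _) (occursAt-head occ) ⟩
    prefixParikh X ⊕ unit x ⊕ parikhˢ (take q L)          ≡⟨ ⊕-assoc (prefixParikh X) (unit x) _ ⟩
    prefixParikh X ⊕ parikhˢ (take (suc q) (x ∷ L))       ∎
  where open ≡-Reasoning

blockPos-occurs : ∀ {L X} q → OccursAt L X → q ≤ length L → blockPos (X + q) ≡ blockPos X + length (σ* (take q L))
blockPos-occurs {L} {X} zero _ _ = trans (cong blockPos (+-identityʳ X)) (sym (+-identityʳ (blockPos X)))
blockPos-occurs {x ∷ L} {X} (suc q) occ (s≤s q≤) =
  begin
    blockPos (X + suc q)                                        ≡⟨ cong blockPos (+-suc X q) ⟩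
    blockPos (suc X + q)                                        ≡⟨ blockPos-occurs q (occursAt-tail occ) q≤ ⟩
    blockPos X + length (σ (padded X)) + length (σ* (take q L)) ≡⟨ cong (λ s → blockPos X + length (σ s) + _) (occursAt-head occ) ⟩
    blockPos X + length (σ x) + length (σ* (take q L))          ≡⟨ +-assoc (blockPos X) _ _ ⟩
    blockPos X + (length (σ x) + length (σ* (take q L)))        ≡⟨ cong (blockPos X +_) (sym (length-++ (σ x))) ⟩
    blockPos X + length (σ* (take (suc q) (x ∷ L)))             ∎
  where open ≡-Reasoning

prefixParikh-blockPos : ∀ Q → prefixParikh (blockPos Q) ≡ M (prefixParikh Q)
prefixParikh-blockPos zero = refl
prefixParikh-blockPos (suc Q) =
  begin
    prefixParikh (blockPos Q + length L)              ≡⟨ prefixParikh-occurs (length L) (σ-block Q) ≤-refl ⟩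
    prefixParikh (blockPos Q) ⊕ parikhˢ (take (length L) L) ≡⟨ cong (λ u → prefixParikh (blockPos Q) ⊕ parikhˢ u) (take-all (length L) L ≤-refl) ⟩
    prefixParikh (blockPos Q) ⊕ parikhˢ L             ≡⟨ cong₂ _⊕_ (prefixParikh-blockPos Q) (parikhˢ-σ (padded Q)) ⟩
    M (prefixParikh Q) ⊕ M (unit (padded Q))          ≡⟨ sym (M-⊕ (prefixParikh Q) (unit (padded Q))) ⟩
    M (prefixParikh (suc Q))                          ∎
  where
  open ≡-Reasoning
  L = σ (padded Q)

blockPos-parikh : ∀ Q → blockPos Q ≡ Q + ∣ prefixParikh Q ∣₀ + ∣ prefixParikh Q ∣₁
blockPos-parikh zero = refl
blockPos-parikh (suc Q) =
  trans (cong₂ _+_ (blockPos-parikh Q) (length-σ (padded Q))) (lemma Q _ _ _ _)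
  where
  lemma : ∀ Q a b a' b' → Q + a + b + (1 + a' + b') ≡ suc Q + (a + a') + (b + b')
  lemma = solve-∀

window-factor : ∀ i n → map just (factor i n) ≡ window (4 + i) n
window-factor i n = trans (sym (map-∘ (upTo n))) (map-upTo _ n)

prefixParikh-factor : ∀ i n → prefixParikh (4 + i + n) ≡ prefixParikh (4 + i) ⊕ parikh (factor i n)
prefixParikh-factor i n =
  begin
    prefixParikh (4 + i + n)                          ≡⟨ prefixParikh-occurs n (window-occurs (4 + i) n) n≤ ⟩
    prefixParikh (4 + i) ⊕ parikhˢ (take n W)         ≡⟨ cong (λ u → prefixParikh (4 + i) ⊕ parikhˢ u) (take-all n W (≤-reflexive (length-applyUpTo _ n))) ⟩
    prefixParikh (4 + i) ⊕ parikhˢ W                  ≡⟨ cong (λ u → prefixParikh (4 + i) ⊕ parikhˢ u) (sym (window-factor i n)) ⟩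
    prefixParikh (4 + i) ⊕ parikhˢ (map just (factor i n)) ≡⟨ cong (prefixParikh (4 + i) ⊕_) (sym (parikh≡parikhˢ (factor i n))) ⟩
    prefixParikh (4 + i) ⊕ parikh (factor i n)        ∎
  where
  open ≡-Reasoning
  W = window (4 + i) n
  n≤ : n ≤ length W
  n≤ = ≤-reflexive (sym (length-applyUpTo _ n))

-- Desubstitution

bit : Bool → ℕ
bit false = 0
bit true = 1

bit≤1 : ∀ b → bit b ≤ 1
bit≤1 false = z≤n
bit≤1 true = ≤-refl

before : ℕ → Sym
before i = padded (3 + i)

LongBlock : Sym → Set
LongBlock a0 = ⊤
LongBlock a1 = ⊤
LongBlock a2 = ⊥
LongBlock □ = ⊥

longBlock? : ∀ s → Dec (LongBlock s)
longBlock? a0 = yes tt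
longBlock? a1 = yes tt
longBlock? a2 = no λ ()
longBlock? □ = no λ ()

length-σ-long : ∀ s → LongBlock s → length (σ s) ≡ 2
length-σ-long a0 _ = refl
length-σ-long a1 _ = refl
length-σ-long a2 ()
length-σ-long □ ()

length-σ-short : ∀ s → ¬ LongBlock s → length (σ s) ≡ 1
length-σ-short a0 short = ⊥-elim (short tt)
length-σ-short a1 short = ⊥-elim (short tt)
length-σ-short a2 _ = refl
length-σ-short □ _ = refl

length-σ-≤2 : ∀ s → length (σ s) ≤ 2
length-σ-≤2 a0 = ≤-refl
length-σ-≤2 a1 = ≤-refl
length-σ-≤2 a2 = s≤s z≤n
length-σ-≤2 □ = s≤s z≤n

length-σ-pos : ∀ s → 0 < length (σ s)
length-σ-pos a0 = s≤s z≤n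
length-σ-pos a1 = s≤s z≤n
length-σ-pos a2 = s≤s z≤n
length-σ-pos □ = s≤s z≤n

lastσ : Sym → Sym
lastσ a0 = a1
lastσ a1 = a2
lastσ a2 = a0
lastσ □ = □

lookup-last-σ : ∀ s → lookupᵈ □ (σ s) (pred (length (σ s))) ≡ lastσ s
lookup-last-σ a0 = refl
lookup-last-σ a1 = refl
lookup-last-σ a2 = refl
lookup-last-σ □ = refl

lookup-first-σ : ∀ x → lookupᵈ □ (σ (just x)) 0 ≡ a0
lookup-first-σ zero = refl
lookup-first-σ (suc zero) = refl
lookup-first-σ (suc (suc zero)) = refl

M-unit-long : ∀ s → LongBlock s → M (unit s) ≡ unit a0 ⊕ unit (lastσ s)
M-unit-long a0 _ = refl
M-unit-long a1 _ = refl
M-unit-long a2 ()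
M-unit-long □ ()

blockPos-first : ∀ k → padded (blockPos (4 + k)) ≡ a0
blockPos-first k =
  trans (cong padded (sym (+-identityʳ _)))
    (trans (σ-block (4 + k) .letterAt 0 (length-σ-pos (just (t k)))) (lookup-first-σ (t k)))

blockPos-last : ∀ Q → padded (pred (blockPos (suc Q))) ≡ lastσ (padded Q)
blockPos-last Q =
  trans (cong padded (pred-+ (blockPos Q) (length-σ-pos (padded Q))))
    (trans (σ-block Q .letterAt _ (pred< (length-σ-pos (padded Q)))) (lookup-last-σ (padded Q)))
  where
  pred-+ : ∀ a {b} → 0 < b → pred (a + b) ≡ a + pred b
  pred-+ a {suc b} _ = cong pred (+-suc a b)
  pred< : ∀ {n} → 0 < n → pred n < n
  pred< {suc n} _ = ≤-refl

blockPos-second : ∀ Q → LongBlock (padded Q) → padded (blockPos Q + 1) ≡ lastσ (padded Q)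
blockPos-second Q long = trans (cong padded eq) (blockPos-last Q)
  where
  eq : blockPos Q + 1 ≡ pred (blockPos Q + length (σ (padded Q)))
  eq = trans (cong pred (sym (+-suc (blockPos Q) 1))) (cong (λ l → pred (blockPos Q + l)) (sym (length-σ-long _ long)))

blockPos-mono : ∀ {Q Q'} → Q ≤ Q' → blockPos Q ≤ blockPos Q'
blockPos-mono {Q} {Q'} Q≤Q' with o , refl ← m≤n⇒∃[o]m+o≡n Q≤Q' = go o
  where
  go : ∀ o → blockPos Q ≤ blockPos (Q + o)
  go zero = ≤-reflexive (cong blockPos (sym (+-identityʳ Q)))
  go (suc o) = ≤-trans (go o) (≤-trans (m≤m+n _ _) (≤-reflexive (cong blockPos (sym (+-suc Q o)))))

blockPos-within : ∀ {Q Q' b} → b < length (σ (padded Q)) → blockPos Q' ≤ blockPos Q + b → Q' ≤ Q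
blockPos-within {Q} {Q'} {b} b< le with Q' ≤? Q
... | yes Q'≤Q = Q'≤Q
... | no Q'≰Q = ⊥-elim (<⇒≱ (≤-trans (+-monoʳ-< (blockPos Q) b<) (blockPos-mono (≰⇒> Q'≰Q))) le)

blockPos-grows : ∀ q → 5 + suc q ≤ blockPos (4 + suc q)
blockPos-grows zero = ≤-refl
blockPos-grows (suc q) = subst (_≤ blockPos (4 + suc (suc q))) (+-comm (5 + suc q) 1) (+-mono-≤ (blockPos-grows q) (length-σ-pos (padded (4 + suc q))))

long-next : ∀ q → LongBlock (padded (4 + q)) → blockPos (4 + q) + 1 + 1 ≡ blockPos (4 + suc q)
long-next q long = trans (+-assoc (blockPos (4 + q)) 1 1) (cong (blockPos (4 + q) +_) (sym (length-σ-long _ long)))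

-- Position k of t is the first (b = false) or the second (b = true) letter of the block τ(t q).
data InBlock : Bool → ℕ → ℕ → Set where
  first : ∀ {q k} → 4 + k ≡ blockPos (4 + q) → InBlock false q k
  second : ∀ {q k} → 4 + k ≡ blockPos (4 + q) + 1 → LongBlock (padded (4 + q)) → InBlock true q k

inBlock-pos : ∀ {b q k} → InBlock b q k → 4 + k ≡ blockPos (4 + q) + bit b
inBlock-pos (first eq) = trans eq (sym (+-identityʳ _))
inBlock-pos (second eq _) = eq

second-then-first : ∀ {q k} → InBlock true q k → InBlock false (suc q) (suc k)
second-then-first {q} (second eq long) =
  first (trans (cong suc eq) (trans (+-comm 1 _) (long-next q long)))

inBlock-exists : ∀ k → ∃[ b ] ∃[ q ] InBlock b q k
inBlock-exists zero = false , 0 , first refl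
inBlock-exists (suc k) with inBlock-exists k
... | _ , q , first eq with longBlock? (padded (4 + q))
...   | yes long = true , q , second (trans (cong suc eq) (+-comm 1 _)) long
...   | no short = false , suc q , first (trans (cong suc eq) (trans (+-comm 1 _) (cong (blockPos (4 + q) +_) (sym (length-σ-short _ short)))))
inBlock-exists (suc k) | _ , q , ib@(second _ _) = false , suc q , second-then-first ib

newAfter : Bool → Sym → Sym
newAfter false _ = a0
newAfter true y = lastσ y

letter-inBlock : ∀ {b q k} → InBlock b q k → padded (4 + k) ≡ newAfter b (padded (4 + q))
letter-inBlock {q = q} (first eq) = trans (cong padded eq) (blockPos-first q)
letter-inBlock {q = q} (second eq long) = trans (cong padded eq) (blockPos-second (4 + q) long)

tailExtra : Bool → ParikhVec
tailExtra false = 𝟘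
tailExtra true = unit a0

prefixParikh-inBlock : ∀ {b q k} → InBlock b q k → prefixParikh (4 + k) ≡ M (prefixParikh (4 + q)) ⊕ tailExtra b
prefixParikh-inBlock {q = q} (first eq) =
  trans (cong prefixParikh eq) (trans (prefixParikh-blockPos (4 + q)) (sym (⊕-identityʳ _)))
prefixParikh-inBlock {q = q} (second eq _) =
  trans (cong prefixParikh (trans eq (+-comm _ 1)))
    (cong₂ _⊕_ (prefixParikh-blockPos (4 + q)) (cong unit (blockPos-first q)))

-- A factor at position i starts either with the block τ(t j) (a = false) or at the second letter
-- of the block τ(t (j ∸ 1)) (a = true).
data StartsAt : Bool → ℕ → ℕ → Set where
  atFirst : ∀ {j i} → InBlock false j i → StartsAt false j i
  atSecond : ∀ {j i} → InBlock true j i → StartsAt true (suc j) i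

startsAt-exists : ∀ i → ∃[ a ] ∃[ j ] StartsAt a j i
startsAt-exists i with inBlock-exists i
... | false , q , ib = false , q , atFirst ib
... | true , q , ib = true , suc q , atSecond ib

headExtra : Bool → Sym → ParikhVec
headExtra false _ = 𝟘
headExtra true x = unit (lastσ x)

newBefore : Bool → Sym → Sym
newBefore false x = lastσ x
newBefore true _ = a0

start-pos : ∀ {a j i} → StartsAt a j i → 4 + i + bit a ≡ blockPos (4 + j)
start-pos (atFirst (first eq)) = trans (+-identityʳ _) eq
start-pos {j = suc q} (atSecond (second eq long)) =
  trans (cong (_+ 1) eq) (long-next q long)

prefixParikh-start : ∀ {a j i} → StartsAt a j i → prefixParikh (4 + i) ⊕ headExtra a (before j) ≡ M (prefixParikh (4 + j))
prefixParikh-start (atFirst ib) = trans (⊕-identityʳ _) (trans (prefixParikh-inBlock ib) (⊕-identityʳ _))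
prefixParikh-start {j = suc q} {i} (atSecond ib@(second _ long)) =
  begin
    prefixParikh (4 + i) ⊕ unit (lastσ x)             ≡⟨ cong (_⊕ unit (lastσ x)) (prefixParikh-inBlock ib) ⟩
    M (prefixParikh (4 + q)) ⊕ unit a0 ⊕ unit (lastσ x) ≡⟨ ⊕-assoc (M (prefixParikh (4 + q))) _ _ ⟩
    M (prefixParikh (4 + q)) ⊕ (unit a0 ⊕ unit (lastσ x)) ≡⟨ cong (M (prefixParikh (4 + q)) ⊕_) (sym (M-unit-long x long)) ⟩
    M (prefixParikh (4 + q)) ⊕ M (unit x)             ≡⟨ sym (M-⊕ (prefixParikh (4 + q)) (unit x)) ⟩
    M (prefixParikh (4 + suc q))                      ∎
  where
  open ≡-Reasoning
  x = padded (4 + q)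

before-start : ∀ {a j i} → StartsAt a j i → before i ≡ newBefore a (before j)
before-start {j = zero} {i} (atFirst (first eq)) with +-cancelˡ-≡ 4 i 0 eq
... | refl = refl
before-start {j = suc q} (atFirst (first eq)) = trans (cong (λ p → padded (pred p)) eq) (blockPos-last (4 + q))
before-start {j = suc q} (atSecond (second eq _)) = trans (cong padded (suc-injective (trans eq (+-comm _ 1)))) (blockPos-first q)

blockPos-factor : ∀ j m → blockPos (4 + j + m) ≡ blockPos (4 + j) + (m + ∣ parikh (factor j m) ∣₀ + ∣ parikh (factor j m) ∣₁)
blockPos-factor j m =
  trans (blockPos-parikh (4 + j + m))
    (trans (cong (λ v → 4 + j + m + ∣ v ∣₀ + ∣ v ∣₁) (prefixParikh-factor j m))
      (trans (lemma (4 + j) m ∣ A ∣₀ ∣ A ∣₁ ∣ P ∣₀ ∣ P ∣₁) (cong (_+ (m + ∣ P ∣₀ + ∣ P ∣₁)) (sym (blockPos-parikh (4 + j))))))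
  where
  A = prefixParikh (4 + j)
  P = parikh (factor j m)
  lemma : ∀ x m a₀ a₁ p₀ p₁ → x + m + (a₀ + p₀) + (a₁ + p₁) ≡ x + a₀ + a₁ + (m + p₀ + p₁)
  lemma = solve-∀

-- The factor of length n at i is a letter (if a) followed by τ(factor j m) and a 0 (if b).
module _ {a b j m i n} (start : StartsAt a j i) (end : InBlock b (j + m) (i + n)) where

  private
    P = parikh (factor j m)
    A = prefixParikh (4 + i)
    open ⊕-Solver using (solve; _⊜_) renaming (_⊕_ to _⊞_)

  parikh-desubst : parikh (factor i n) ≡ headExtra a (before j) ⊕ M P ⊕ tailExtra b
  parikh-desubst = ⊕-cancelˡ _ _ A (begin
    A ⊕ parikh (factor i n)                             ≡⟨ sym (prefixParikh-factor i n) ⟩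
    prefixParikh (4 + (i + n))                          ≡⟨ prefixParikh-inBlock end ⟩
    M (prefixParikh (4 + j + m)) ⊕ tailExtra b          ≡⟨ cong (λ v → M v ⊕ tailExtra b) (prefixParikh-factor j m) ⟩
    M (prefixParikh (4 + j) ⊕ P) ⊕ tailExtra b          ≡⟨ cong (_⊕ tailExtra b) (M-⊕ (prefixParikh (4 + j)) P) ⟩
    M (prefixParikh (4 + j)) ⊕ M P ⊕ tailExtra b        ≡⟨ cong (λ v → v ⊕ M P ⊕ tailExtra b) (sym (prefixParikh-start start)) ⟩
    A ⊕ headExtra a (before j) ⊕ M P ⊕ tailExtra b      ≡⟨ solve 4 (λ x y z w → ((x ⊞ y) ⊞ z) ⊞ w ⊜ x ⊞ ((y ⊞ z) ⊞ w)) refl A _ _ _ ⟩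
    A ⊕ (headExtra a (before j) ⊕ M P ⊕ tailExtra b)    ∎)
    where open ≡-Reasoning

  length-desubst : n ≡ m + ∣ P ∣₀ + ∣ P ∣₁ + bit a + bit b
  length-desubst = +-cancelˡ-≡ (blockPos (4 + j)) n _ (begin
    blockPos (4 + j) + n                                 ≡⟨ cong (_+ n) (sym (start-pos start)) ⟩
    4 + i + bit a + n                                    ≡⟨ lemma₁ i (bit a) n ⟩
    4 + (i + n) + bit a                                  ≡⟨ cong (_+ bit a) (inBlock-pos end) ⟩
    blockPos (4 + j + m) + bit b + bit a                 ≡⟨ cong (λ p → p + bit b + bit a) (blockPos-factor j m) ⟩
    blockPos (4 + j) + (m + ∣ P ∣₀ + ∣ P ∣₁) + bit b + bit a ≡⟨ lemma₂ (blockPos (4 + j)) (m + ∣ P ∣₀ + ∣ P ∣₁) (bit a) (bit b) ⟩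
    blockPos (4 + j) + (m + ∣ P ∣₀ + ∣ P ∣₁ + bit a + bit b) ∎)
    where
    open ≡-Reasoning
    lemma₁ : ∀ i a n → 4 + i + a + n ≡ 4 + (i + n) + a
    lemma₁ = solve-∀
    lemma₂ : ∀ x y a b → x + y + b + a ≡ x + (y + a + b)
    lemma₂ = solve-∀

record Desubstitution (i n : ℕ) : Set where
  field
    {a b} : Bool
    {j m} : ℕ
    start : StartsAt a j i
    end : InBlock b (j + m) (i + n)
    shorter : j + m < i + n

bit<length-σ : ∀ {b q k} → InBlock b q k → bit b < length (σ (padded (4 + q)))
bit<length-σ {q = q} (first _) = length-σ-pos (padded (4 + q))
bit<length-σ {q = q} (second _ long) = subst (1 <_) (sym (length-σ-long (padded (4 + q)) long)) ≤-refl

desubstitute : ∀ i n → 1 ≤ n → Desubstitution i n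
desubstitute i n 1≤n with a , j , start ← startsAt-exists i | b , E , end ← inBlock-exists (i + n) =
  record { start = start ; end = subst (λ e → InBlock b e (i + n)) (sym (m+[n∸m]≡n j≤E)) end
         ; shorter = subst (_< i + n) (sym (m+[n∸m]≡n j≤E)) (E<i+n E (inBlock-pos end)) }
  where
  j≤E : j ≤ E
  j≤E = +-cancelˡ-≤ 4 j E (blockPos-within (bit<length-σ end) (begin
    blockPos (4 + j)          ≡⟨ sym (start-pos start) ⟩
    4 + i + bit a             ≤⟨ +-monoʳ-≤ (4 + i) (≤-trans (bit≤1 a) 1≤n) ⟩
    4 + i + n                 ≡⟨ inBlock-pos end ⟩
    blockPos (4 + E) + bit b  ∎))
    where open ≤-Reasoning hiding (start)
  E<i+n : ∀ E → 4 + (i + n) ≡ blockPos (4 + E) + bit b → E < i + n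
  E<i+n zero _ = ≤-trans 1≤n (m≤n+m n i)
  E<i+n (suc q) eq = +-cancelˡ-< 4 (suc q) (i + n)
    (≤-trans (blockPos-grows q) (≤-trans (m≤m+n _ (bit b)) (≤-reflexive (sym eq))))

Guard : Bool → Sym → Set
Guard false _ = ⊤
Guard true s = LongBlock s

guard? : ∀ b s → Dec (Guard b s)
guard? false s = yes tt
guard? true s = longBlock? s

blockPos-≥ : ∀ Q → Q ≤ blockPos Q
blockPos-≥ zero = z≤n
blockPos-≥ (suc Q) = subst (_≤ blockPos (suc Q)) (+-comm Q 1) (+-mono-≤ (blockPos-≥ Q) (length-σ-pos (padded Q)))

inBlock-at : ∀ b q → Guard b (padded (4 + q)) → InBlock b q (blockPos (4 + q) + bit b ∸ 4)
inBlock-at false q _ = first (trans (m+[n∸m]≡n 4≤) (+-identityʳ _))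
  where 4≤ : 4 ≤ blockPos (4 + q) + 0
        4≤ = ≤-trans (m≤m+n 4 q) (≤-trans (blockPos-≥ (4 + q)) (m≤m+n _ 0))
inBlock-at true q long = second (m+[n∸m]≡n 4≤) long
  where 4≤ : 4 ≤ blockPos (4 + q) + 1
        4≤ = ≤-trans (m≤m+n 4 q) (≤-trans (blockPos-≥ (4 + q)) (m≤m+n _ 1))

startsAt-guarded : ∀ a j → Guard a (before j) → ∃[ i ] StartsAt a j i
startsAt-guarded false j _ = _ , atFirst (inBlock-at false j tt)
startsAt-guarded true (suc j) long = _ , atSecond (inBlock-at true j long)

endsAt-guarded : ∀ {a j i} b m → StartsAt a j i → Guard b (padded (4 + (j + m))) → ∃[ n ] InBlock b (j + m) (i + n)
endsAt-guarded {a} {j} {i} b m start g =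
  k ∸ i , subst (InBlock b (j + m)) (sym (m+[n∸m]≡n i≤k)) end
  where
  k = blockPos (4 + (j + m)) + bit b ∸ 4
  end = inBlock-at b (j + m) g
  i≤k : i ≤ k
  i≤k = +-cancelˡ-≤ 4 i k (begin
    4 + i                          ≤⟨ m≤m+n (4 + i) (bit a) ⟩
    4 + i + bit a                  ≡⟨ start-pos start ⟩
    blockPos (4 + j)               ≤⟨ blockPos-mono (+-monoʳ-≤ 4 (m≤m+n j m)) ⟩
    blockPos (4 + (j + m))         ≤⟨ m≤m+n _ (bit b) ⟩
    blockPos (4 + (j + m)) + bit b ≡⟨ sym (inBlock-pos end) ⟩
    4 + k                          ∎)
    where open ≤-Reasoning hiding (start)

guard-inBlock : ∀ {b q k} → InBlock b q k → Guard b (padded (4 + q))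
guard-inBlock (first _) = tt
guard-inBlock (second _ long) = long

guard-start : ∀ {a j i} → StartsAt a j i → Guard a (before j)
guard-start (atFirst _) = tt
guard-start (atSecond (second _ long)) = long

infix 4 _≟ˢ_ _≟ᵥ_ _≟ʷ_

_≟ˢ_ : DecidableEquality Sym
_≟ˢ_ = Maybe.≡-dec _≟ᶠ_

_≟ᵥ_ : DecidableEquality ParikhVec
_≟ᵥ_ = Product.≡-dec _≟_ (Product.≡-dec _≟_ _≟_)

_≟ʷ_ : DecidableEquality (List Sym)
_≟ʷ_ = List.≡-dec _≟ˢ_

_⊖_ : ParikhVec → ParikhVec → ParikhVec
(a , b , c) ⊖ (a' , b' , c') = a ∸ a' , b ∸ b' , c ∸ c'

⊕-⊖ : ∀ u v → (u ⊕ v) ⊖ v ≡ u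
⊕-⊖ (a , b , c) (a' , b' , c') = cong₂ _,_ (m+n∸n≡m a a') (cong₂ _,_ (m+n∸n≡m b b') (m+n∸n≡m c c'))

-- The state of the factor of length n at position i: the letters just before and just after it,
-- and the excess e of its Parikh vector over that of the prefix of length n, shifted by 𝟙 to stay in ℕ.
State : Set
State = Sym × ParikhVec × Sym

record HasState (i n : ℕ) (s : State) : Set where
  constructor hasState
  field
    before-eq : before i ≡ proj₁ s
    excess-eq : parikh (factor i n) ⊕ 𝟙 ≡ prefixParikh (4 + n) ⊕ proj₁ (proj₂ s)
    after-eq : padded (4 + i + n) ≡ proj₂ (proj₂ s)

hasState? : ∀ i n s → Dec (HasState i n s)
hasState? i n (x , e , y) with before i ≟ˢ x | parikh (factor i n) ⊕ 𝟙 ≟ᵥ prefixParikh (4 + n) ⊕ e | padded (4 + i + n) ≟ˢ y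
... | yes p | yes q | yes r = yes (hasState p q r)
... | no ¬p | _ | _ = no λ h → ¬p (HasState.before-eq h)
... | yes _ | no ¬q | _ = no λ h → ¬q (HasState.excess-eq h)
... | yes _ | yes _ | no ¬r = no λ h → ¬r (HasState.after-eq h)

ctx : ℕ → List Sym
ctx n = window n 9

excessOf : State → ParikhVec
excessOf (_ , e , _) = e

-- The step from a factor of length m with state s, where m + β = k, to the factor read off from
-- σ*(ctx k) with an extra letter in front if a and an extra 0 at the end if b: the new factor starts
-- at offset in σ*(ctx k), and offset and excess are forced by its length and Parikh vector (6 and M 𝟙
-- account for the shift by 𝟙 and the four holes). step? checks that these forced values are consistent.
record Step (c : List Sym) (β : ℕ) (s : State) (a b : Bool) : Set where
  field
    offset : ℕ
    excess : ParikhVec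
    β≤4 : β ≤ 4
    offset-eq : offset + 6 ≡ length (σ* (take (4 ∸ β) c)) + ∣ excessOf s ∣₀ + ∣ excessOf s ∣₁ + bit a + bit b
    fits : offset + 9 ≤ length (σ* c)
    excess-eq : parikhˢ (take (offset + 4) (σ* c)) ⊕ excess ⊕ M 𝟙
                ≡ M (parikhˢ (take (4 ∸ β) c)) ⊕ M (excessOf s) ⊕ headExtra a (proj₁ s) ⊕ tailExtra b ⊕ 𝟙

childState : ∀ {c β s a b} → Step c β s a b → State
childState {s = x , _ , y} {a} {b} st = newBefore a x , Step.excess st , newAfter b y

childContext : ∀ {c β s a b} → Step c β s a b → List Sym
childContext {c} st = take 9 (drop (Step.offset st) (σ* c))

module _ (c : List Sym) (β : ℕ) (s : State) (a b : Bool) where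
  private
    len = length (σ* (take (4 ∸ β) c)) + ∣ excessOf s ∣₀ + ∣ excessOf s ∣₁ + bit a + bit b
    image = parikhˢ (take (len ∸ 6 + 4) (σ* c))
    rhs = M (parikhˢ (take (4 ∸ β) c)) ⊕ M (excessOf s) ⊕ headExtra a (proj₁ s) ⊕ tailExtra b ⊕ 𝟙

  step? : Maybe (Step c β s a b)
  step? with β ≤? 4 | 6 ≤? len | len ∸ 6 + 9 ≤? length (σ* c)
  ... | yes β≤4 | yes 6≤ | yes fits with image ⊕ (rhs ⊖ (image ⊕ M 𝟙)) ⊕ M 𝟙 ≟ᵥ rhs
  ...   | yes eq = just record { offset = len ∸ 6 ; excess = rhs ⊖ (image ⊕ M 𝟙) ; β≤4 = β≤4
                               ; offset-eq = m∸n+n≡m 6≤ ; fits = fits ; excess-eq = eq }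
  ...   | no _ = nothing
  step? | _ | _ | _ = nothing

module _ {j m i n a b k β s} (has : HasState j m s) (start : StartsAt a j i) (end : InBlock b (j + m) (i + n))
         (m+β≡k : m + β ≡ k) (st : Step (ctx k) β s a b) where

  open Step st
  open ⊕-Solver using (solve; _⊜_) renaming (_⊕_ to _⊞_)

  private
    c = ctx k
    P = parikh (factor j m)
    e = excessOf s
    pre = take (4 ∸ β) c

    4+m≡ : 4 + m ≡ k + (4 ∸ β)
    4+m≡ = trans (+-comm 4 m) (trans (cong (m +_) (sym (m+[n∸m]≡n β≤4))) (trans (sym (+-assoc m β _)) (cong (_+ (4 ∸ β)) m+β≡k)))

    pre≤ : 4 ∸ β ≤ length c
    pre≤ = ≤-trans (m∸n≤m 4 β) (subst (4 ≤_) (sym (length-applyUpTo (λ j → padded (k + j)) 9)) (s≤s (s≤s (s≤s (s≤s z≤n)))))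

    image-occurs : OccursAt (σ* c) (blockPos k)
    image-occurs = occursAt-σ* (window-occurs k 9)

    blockPos-m : blockPos (4 + m) ≡ blockPos k + length (σ* pre)
    blockPos-m = trans (cong blockPos 4+m≡) (blockPos-occurs (4 ∸ β) (window-occurs k 9) pre≤)

    prefixParikh-m : prefixParikh (4 + m) ≡ prefixParikh k ⊕ parikhˢ pre
    prefixParikh-m = trans (cong prefixParikh 4+m≡) (prefixParikh-occurs (4 ∸ β) (window-occurs k 9) pre≤)

    count-m : ∀ (f : ParikhVec → ℕ) → (∀ u v → f (u ⊕ v) ≡ f u + f v) → f P + f 𝟙 ≡ f (prefixParikh (4 + m)) + f e
    count-m f f-⊕ = trans (sym (f-⊕ P 𝟙)) (trans (cong f (HasState.excess-eq has)) (f-⊕ _ e))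

  step-length : n ≡ blockPos k + offset
  step-length = +-cancelʳ-≡ 6 n _ (begin
    n + 6
      ≡⟨ cong (_+ 6) (length-desubst start end) ⟩
    m + ∣ P ∣₀ + ∣ P ∣₁ + bit a + bit b + 6
      ≡⟨ lemma₁ m ∣ P ∣₀ ∣ P ∣₁ (bit a) (bit b) ⟩
    4 + m + (∣ P ∣₀ + 1) + (∣ P ∣₁ + 1) + bit a + bit b
      ≡⟨ cong₂ (λ p q → 4 + m + p + q + bit a + bit b) (count-m ∣_∣₀ (λ _ _ → refl)) (count-m ∣_∣₁ (λ _ _ → refl)) ⟩
    4 + m + (∣ A ∣₀ + ∣ e ∣₀) + (∣ A ∣₁ + ∣ e ∣₁) + bit a + bit b
      ≡⟨ lemma₂ (4 + m) ∣ A ∣₀ ∣ e ∣₀ ∣ A ∣₁ ∣ e ∣₁ (bit a) (bit b) ⟩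
    4 + m + ∣ A ∣₀ + ∣ A ∣₁ + (∣ e ∣₀ + ∣ e ∣₁ + bit a + bit b)
      ≡⟨ cong (_+ (∣ e ∣₀ + ∣ e ∣₁ + bit a + bit b)) (trans (sym (blockPos-parikh (4 + m))) blockPos-m) ⟩
    blockPos k + length (σ* pre) + (∣ e ∣₀ + ∣ e ∣₁ + bit a + bit b)
      ≡⟨ lemma₃ (blockPos k) (length (σ* pre)) ∣ e ∣₀ ∣ e ∣₁ (bit a) (bit b) ⟩
    blockPos k + (length (σ* pre) + ∣ e ∣₀ + ∣ e ∣₁ + bit a + bit b)
      ≡⟨ cong (blockPos k +_) (sym offset-eq) ⟩
    blockPos k + (offset + 6)
      ≡⟨ sym (+-assoc (blockPos k) offset 6) ⟩
    blockPos k + offset + 6 ∎)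
    where
    open ≡-Reasoning
    A = prefixParikh (4 + m)
    lemma₁ : ∀ m p q x y → m + p + q + x + y + 6 ≡ 4 + m + (p + 1) + (q + 1) + x + y
    lemma₁ = solve-∀
    lemma₂ : ∀ z a e a' e' x y → z + (a + e) + (a' + e') + x + y ≡ z + a + a' + (e + e' + x + y)
    lemma₂ = solve-∀
    lemma₃ : ∀ p l e e' x y → p + l + (e + e' + x + y) ≡ p + (l + e + e' + x + y)
    lemma₃ = solve-∀

  step-context : ctx n ≡ childContext st
  step-context =
    trans (cong (λ p → window p 9) step-length)
      (window-occursAt 9 (occursAt-drop offset image-occurs)
        (subst (9 ≤_) (sym (length-drop offset (σ* c))) (m+n≤o⇒m≤o∸n 9 (subst (_≤ length (σ* c)) (+-comm offset 9) fits))))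

  private
    prefixParikh-n : prefixParikh (4 + n) ≡ M (prefixParikh k) ⊕ parikhˢ (take (offset + 4) (σ* c))
    prefixParikh-n =
      trans (cong prefixParikh (trans (cong (4 +_) step-length) (lemma (blockPos k) offset)))
        (trans (prefixParikh-occurs (offset + 4) image-occurs (≤-trans (+-monoʳ-≤ offset (s≤s (s≤s (s≤s (s≤s z≤n))))) fits))
          (cong (_⊕ parikhˢ (take (offset + 4) (σ* c))) (prefixParikh-blockPos k)))
      where
      lemma : ∀ p q → 4 + (p + q) ≡ p + (q + 4)
      lemma = solve-∀

  step-state : HasState i n (childState st)
  step-state = hasState
    (trans (before-start start) (cong (newBefore a) (HasState.before-eq has)))
    (⊕-cancelʳ _ _ (M 𝟙) (begin
      parikh (factor i n) ⊕ 𝟙 ⊕ M 𝟙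
        ≡⟨ cong (λ v → v ⊕ 𝟙 ⊕ M 𝟙) (trans (parikh-desubst start end) (cong (λ x → headExtra a x ⊕ M P ⊕ tb) (HasState.before-eq has))) ⟩
      hx ⊕ M P ⊕ tb ⊕ 𝟙 ⊕ M 𝟙
        ≡⟨ solve 5 (λ h p t o m → (((h ⊞ p) ⊞ t) ⊞ o) ⊞ m ⊜ (p ⊞ m) ⊞ ((h ⊞ t) ⊞ o)) refl hx (M P) tb 𝟙 (M 𝟙) ⟩
      (M P ⊕ M 𝟙) ⊕ (hx ⊕ tb ⊕ 𝟙)
        ≡⟨ cong (_⊕ (hx ⊕ tb ⊕ 𝟙)) (trans (sym (M-⊕ P 𝟙)) (cong M (trans (HasState.excess-eq has) (cong (_⊕ e) prefixParikh-m)))) ⟩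
      M (prefixParikh k ⊕ parikhˢ pre ⊕ e) ⊕ (hx ⊕ tb ⊕ 𝟙)
        ≡⟨ cong (_⊕ (hx ⊕ tb ⊕ 𝟙)) (trans (M-⊕ (prefixParikh k ⊕ parikhˢ pre) e) (cong (_⊕ M e) (M-⊕ (prefixParikh k) (parikhˢ pre)))) ⟩
      M (prefixParikh k) ⊕ M (parikhˢ pre) ⊕ M e ⊕ (hx ⊕ tb ⊕ 𝟙)
        ≡⟨ solve 6 (λ K p e h t o → ((K ⊞ p) ⊞ e) ⊞ ((h ⊞ t) ⊞ o) ⊜ K ⊞ ((((p ⊞ e) ⊞ h) ⊞ t) ⊞ o)) refl
             (M (prefixParikh k)) (M (parikhˢ pre)) (M e) hx tb 𝟙 ⟩
      M (prefixParikh k) ⊕ (M (parikhˢ pre) ⊕ M e ⊕ hx ⊕ tb ⊕ 𝟙)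
        ≡⟨ cong (M (prefixParikh k) ⊕_) (sym excess-eq) ⟩
      M (prefixParikh k) ⊕ (parikhˢ (take (offset + 4) (σ* c)) ⊕ excess ⊕ M 𝟙)
        ≡⟨ solve 4 (λ K q x m → K ⊞ ((q ⊞ x) ⊞ m) ⊜ ((K ⊞ q) ⊞ x) ⊞ m) refl
             (M (prefixParikh k)) (parikhˢ (take (offset + 4) (σ* c))) excess (M 𝟙) ⟩
      M (prefixParikh k) ⊕ parikhˢ (take (offset + 4) (σ* c)) ⊕ excess ⊕ M 𝟙
        ≡⟨ cong (λ v → v ⊕ excess ⊕ M 𝟙) (sym prefixParikh-n) ⟩
      prefixParikh (4 + n) ⊕ excess ⊕ M 𝟙 ∎))
    (trans (letter-inBlock end) (cong (newAfter b) (HasState.after-eq has)))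
    where
    open ≡-Reasoning
    hx = headExtra a (proj₁ s)
    tb = tailExtra b

-- The table of reachable states

_≟ˢᵗ_ : DecidableEquality State
_≟ˢᵗ_ = Product.≡-dec _≟ˢ_ (Product.≡-dec _≟ᵥ_ _≟ˢ_)

open import Data.List.Membership.DecPropositional _≟ˢᵗ_ using (_∈?_)

Table : Set → Set
Table A = List (List Sym × List A)

entries : ∀ {A : Set} → Table A → List Sym → List A
entries [] c = []
entries ((c' , xs) ∷ T) c with c ≟ʷ c'
... | yes _ = xs
... | no _ = entries T c

entries-key : ∀ {A : Set} (T : Table A) c {x} → x ∈ entries T c → (c , entries T c) ∈ T
entries-key ((c' , xs) ∷ T) c x∈ with c ≟ʷ c'
... | yes refl = here refl
... | no _ = there (entries-key T c x∈)

flags : List (Bool × Bool)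
flags = (false , false) ∷ (false , true) ∷ (true , false) ∷ (true , true) ∷ []

flags-complete : ∀ a b → (a , b) ∈ flags
flags-complete false false = here refl
flags-complete false true = there (here refl)
flags-complete true false = there (there (here refl))
flags-complete true true = there (there (there (here refl)))

-- Generated by closing the initial states under closedStep; only the closure is checked here.
reachableStates : Table State
reachableStates =
    (a0 ∷ a0 ∷ a1 ∷ a0 ∷ a2 ∷ a0 ∷ a1 ∷ a0 ∷ a0 ∷ [] ,
       (a0 , (0 , 1 , 2) , a0) ∷ (a0 , (0 , 1 , 2) , a1) ∷ (a0 , (0 , 2 , 1) , a0) ∷
       (a0 , (1 , 0 , 2) , a1) ∷ (a0 , (1 , 1 , 1) , a1) ∷ (a0 , (1 , 1 , 1) , a2) ∷
       (a1 , (0 , 1 , 2) , a0) ∷ (a1 , (1 , 0 , 2) , a0) ∷ (a1 , (1 , 0 , 2) , a1) ∷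
       (a1 , (1 , 1 , 1) , a0) ∷ (a1 , (1 , 1 , 1) , a2) ∷ (a2 , (1 , 1 , 1) , a0) ∷
       (a2 , (1 , 1 , 1) , a1) ∷ (a2 , (1 , 1 , 1) , a2) ∷ (□ , (1 , 1 , 1) , a2) ∷ [])
  ∷ (a0 ∷ a0 ∷ a1 ∷ a0 ∷ a2 ∷ a0 ∷ a1 ∷ a0 ∷ a1 ∷ [] ,
       (a0 , (0 , 0 , 3) , a1) ∷ (a0 , (0 , 1 , 2) , a0) ∷ (a0 , (0 , 1 , 2) , a1) ∷
       (a0 , (0 , 1 , 2) , a2) ∷ (a0 , (0 , 2 , 1) , a0) ∷ (a0 , (0 , 2 , 1) , a2) ∷
       (a0 , (1 , 1 , 1) , a1) ∷ (a0 , (1 , 1 , 1) , a2) ∷ (a1 , (0 , 0 , 3) , a0) ∷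
       (a1 , (0 , 1 , 2) , a0) ∷ (a1 , (1 , 0 , 2) , a1) ∷ (a1 , (1 , 1 , 1) , a0) ∷
       (a1 , (1 , 1 , 1) , a1) ∷ (a1 , (1 , 1 , 1) , a2) ∷ (a2 , (0 , 1 , 2) , a0) ∷
       (a2 , (0 , 2 , 1) , a0) ∷ (a2 , (1 , 1 , 1) , a0) ∷ (a2 , (1 , 1 , 1) , a1) ∷
       (a2 , (1 , 1 , 1) , a2) ∷ (□ , (1 , 1 , 1) , a2) ∷ [])
  ∷ (a0 ∷ a0 ∷ a1 ∷ a0 ∷ a2 ∷ a0 ∷ a1 ∷ a0 ∷ a2 ∷ [] ,
       (a0 , (0 , 0 , 3) , a0) ∷ (a0 , (0 , 0 , 3) , a1) ∷ (a0 , (0 , 1 , 2) , a0) ∷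
       (a0 , (0 , 1 , 2) , a1) ∷ (a0 , (0 , 1 , 2) , a2) ∷ (a0 , (0 , 2 , 1) , a0) ∷
       (a0 , (1 , 0 , 2) , a1) ∷ (a0 , (1 , 1 , 1) , a1) ∷ (a0 , (1 , 1 , 1) , a2) ∷
       (a1 , (0 , 0 , 3) , a0) ∷ (a1 , (0 , 1 , 2) , a0) ∷ (a1 , (1 , 0 , 2) , a0) ∷
       (a1 , (1 , 0 , 2) , a1) ∷ (a1 , (1 , 0 , 2) , a2) ∷ (a1 , (1 , 1 , 1) , a0) ∷
       (a1 , (1 , 1 , 1) , a2) ∷ (a2 , (0 , 1 , 2) , a0) ∷ (a2 , (1 , 0 , 2) , a1) ∷
       (a2 , (1 , 1 , 1) , a0) ∷ (a2 , (1 , 1 , 1) , a1) ∷ (a2 , (1 , 1 , 1) , a2) ∷ (□ , (1 , 1 , 1) , a2) ∷ [])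
  ∷ (a0 ∷ a1 ∷ a0 ∷ a0 ∷ a1 ∷ a0 ∷ a2 ∷ a0 ∷ a1 ∷ [] ,
       (a0 , (0 , 1 , 2) , a0) ∷ (a0 , (0 , 1 , 2) , a1) ∷ (a0 , (0 , 1 , 2) , a2) ∷
       (a0 , (0 , 2 , 1) , a0) ∷ (a0 , (0 , 2 , 1) , a1) ∷ (a0 , (0 , 2 , 1) , a2) ∷
       (a0 , (1 , 1 , 1) , a1) ∷ (a0 , (1 , 1 , 1) , a2) ∷ (a0 , (1 , 2 , 0) , a2) ∷
       (a1 , (0 , 1 , 2) , a0) ∷ (a1 , (0 , 2 , 1) , a0) ∷ (a1 , (1 , 0 , 2) , a1) ∷
       (a1 , (1 , 1 , 1) , a0) ∷ (a1 , (1 , 1 , 1) , a1) ∷ (a1 , (1 , 1 , 1) , a2) ∷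
       (a2 , (0 , 1 , 2) , a0) ∷ (a2 , (0 , 2 , 1) , a0) ∷ (a2 , (1 , 1 , 1) , a0) ∷
       (a2 , (1 , 1 , 1) , a1) ∷ (a2 , (1 , 1 , 1) , a2) ∷ (a2 , (1 , 2 , 0) , a0) ∷
       (a2 , (1 , 2 , 0) , a2) ∷ (□ , (1 , 1 , 1) , a1) ∷ [])
  ∷ (a0 ∷ a1 ∷ a0 ∷ a1 ∷ a0 ∷ a2 ∷ a0 ∷ a1 ∷ a0 ∷ [] ,
       (a0 , (0 , 1 , 2) , a0) ∷ (a0 , (1 , 0 , 2) , a0) ∷ (a0 , (1 , 0 , 2) , a1) ∷
       (a0 , (1 , 0 , 2) , a2) ∷ (a0 , (1 , 1 , 1) , a0) ∷ (a0 , (1 , 1 , 1) , a1) ∷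
       (a0 , (1 , 1 , 1) , a2) ∷ (a0 , (2 , 0 , 1) , a1) ∷ (a1 , (1 , 0 , 2) , a0) ∷
       (a1 , (1 , 0 , 2) , a1) ∷ (a1 , (1 , 1 , 1) , a0) ∷ (a1 , (2 , 0 , 1) , a0) ∷
       (a1 , (2 , 0 , 1) , a1) ∷ (a1 , (2 , 0 , 1) , a2) ∷ (a2 , (1 , 0 , 2) , a0) ∷
       (a2 , (1 , 1 , 1) , a0) ∷ (a2 , (2 , 0 , 1) , a1) ∷ (a2 , (2 , 1 , 0) , a2) ∷ (□ , (1 , 1 , 1) , a0) ∷ [])
  ∷ (a0 ∷ a1 ∷ a0 ∷ a2 ∷ a0 ∷ a1 ∷ a0 ∷ a0 ∷ a1 ∷ [] ,
       (a0 , (0 , 2 , 1) , a0) ∷ (a0 , (1 , 0 , 2) , a1) ∷ (a0 , (1 , 1 , 1) , a0) ∷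
       (a0 , (1 , 1 , 1) , a1) ∷ (a0 , (1 , 1 , 1) , a2) ∷ (a0 , (1 , 2 , 0) , a0) ∷
       (a0 , (1 , 2 , 0) , a1) ∷ (a0 , (1 , 2 , 0) , a2) ∷ (a0 , (2 , 1 , 0) , a1) ∷
       (a0 , (2 , 1 , 0) , a2) ∷ (a1 , (1 , 0 , 2) , a0) ∷ (a1 , (1 , 1 , 1) , a0) ∷
       (a1 , (1 , 2 , 0) , a0) ∷ (a1 , (2 , 0 , 1) , a1) ∷ (a1 , (2 , 1 , 0) , a0) ∷
       (a1 , (2 , 1 , 0) , a1) ∷ (a1 , (2 , 1 , 0) , a2) ∷ (a2 , (1 , 1 , 1) , a0) ∷
       (a2 , (1 , 2 , 0) , a0) ∷ (a2 , (2 , 1 , 0) , a0) ∷ (a2 , (2 , 1 , 0) , a1) ∷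
       (a2 , (2 , 1 , 0) , a2) ∷ (□ , (1 , 1 , 1) , a0) ∷ [])
  ∷ (a0 ∷ a1 ∷ a0 ∷ a2 ∷ a0 ∷ a1 ∷ a0 ∷ a1 ∷ a0 ∷ [] ,
       (a0 , (0 , 1 , 2) , a0) ∷ (a0 , (0 , 2 , 1) , a0) ∷ (a0 , (1 , 1 , 1) , a0) ∷
       (a0 , (1 , 1 , 1) , a1) ∷ (a0 , (1 , 1 , 1) , a2) ∷ (a0 , (1 , 2 , 0) , a0) ∷
       (a0 , (1 , 2 , 0) , a1) ∷ (a0 , (1 , 2 , 0) , a2) ∷ (a1 , (1 , 0 , 2) , a1) ∷
       (a1 , (1 , 1 , 1) , a0) ∷ (a1 , (1 , 1 , 1) , a1) ∷ (a1 , (1 , 1 , 1) , a2) ∷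
       (a1 , (1 , 2 , 0) , a0) ∷ (a1 , (2 , 1 , 0) , a1) ∷ (a1 , (2 , 1 , 0) , a2) ∷
       (a2 , (1 , 1 , 1) , a0) ∷ (a2 , (1 , 1 , 1) , a1) ∷ (a2 , (1 , 2 , 0) , a0) ∷
       (a2 , (1 , 2 , 0) , a2) ∷ (a2 , (2 , 1 , 0) , a1) ∷ (□ , (1 , 1 , 1) , a0) ∷ [])
  ∷ (a0 ∷ a1 ∷ a0 ∷ a2 ∷ a0 ∷ a1 ∷ a0 ∷ a2 ∷ a0 ∷ [] ,
       (a0 , (0 , 1 , 2) , a0) ∷ (a0 , (0 , 2 , 1) , a0) ∷ (a0 , (1 , 0 , 2) , a1) ∷
       (a0 , (1 , 1 , 1) , a0) ∷ (a0 , (1 , 1 , 1) , a1) ∷ (a0 , (1 , 1 , 1) , a2) ∷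
       (a0 , (1 , 2 , 0) , a0) ∷ (a0 , (1 , 2 , 0) , a2) ∷ (a1 , (1 , 0 , 2) , a0) ∷
       (a1 , (1 , 0 , 2) , a1) ∷ (a1 , (1 , 1 , 1) , a0) ∷ (a1 , (1 , 1 , 1) , a2) ∷
       (a1 , (2 , 0 , 1) , a1) ∷ (a1 , (2 , 1 , 0) , a2) ∷ (a2 , (1 , 1 , 1) , a0) ∷
       (a2 , (1 , 1 , 1) , a1) ∷ (a2 , (1 , 2 , 0) , a0) ∷ (a2 , (2 , 1 , 0) , a1) ∷
       (a2 , (2 , 1 , 0) , a2) ∷ (□ , (1 , 1 , 1) , a0) ∷ [])
  ∷ (a0 ∷ a2 ∷ a0 ∷ a1 ∷ a0 ∷ a0 ∷ a1 ∷ a0 ∷ a2 ∷ [] ,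
       (a0 , (1 , 0 , 2) , a0) ∷ (a0 , (1 , 0 , 2) , a1) ∷ (a0 , (1 , 1 , 1) , a0) ∷
       (a0 , (1 , 1 , 1) , a1) ∷ (a0 , (1 , 1 , 1) , a2) ∷ (a0 , (1 , 2 , 0) , a0) ∷
       (a0 , (1 , 2 , 0) , a2) ∷ (a0 , (2 , 0 , 1) , a1) ∷ (a0 , (2 , 1 , 0) , a1) ∷
       (a0 , (2 , 1 , 0) , a2) ∷ (a1 , (1 , 0 , 2) , a0) ∷ (a1 , (1 , 1 , 1) , a0) ∷
       (a1 , (2 , 0 , 1) , a0) ∷ (a1 , (2 , 0 , 1) , a1) ∷ (a1 , (2 , 0 , 1) , a2) ∷
       (a1 , (2 , 1 , 0) , a0) ∷ (a1 , (2 , 1 , 0) , a2) ∷ (a2 , (1 , 1 , 1) , a0) ∷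
       (a2 , (1 , 2 , 0) , a0) ∷ (a2 , (2 , 0 , 1) , a1) ∷ (a2 , (2 , 1 , 0) , a0) ∷
       (a2 , (2 , 1 , 0) , a1) ∷ (a2 , (2 , 1 , 0) , a2) ∷ (□ , (1 , 1 , 1) , a0) ∷ [])
  ∷ (a0 ∷ a2 ∷ a0 ∷ a1 ∷ a0 ∷ a1 ∷ a0 ∷ a2 ∷ a0 ∷ [] ,
       (a0 , (0 , 1 , 2) , a0) ∷ (a0 , (0 , 2 , 1) , a0) ∷ (a0 , (1 , 0 , 2) , a1) ∷
       (a0 , (1 , 1 , 1) , a0) ∷ (a0 , (1 , 1 , 1) , a1) ∷ (a0 , (1 , 1 , 1) , a2) ∷
       (a0 , (1 , 2 , 0) , a0) ∷ (a0 , (1 , 2 , 0) , a2) ∷ (a1 , (1 , 0 , 2) , a0) ∷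
       (a1 , (1 , 0 , 2) , a1) ∷ (a1 , (1 , 1 , 1) , a0) ∷ (a1 , (1 , 1 , 1) , a2) ∷
       (a1 , (2 , 0 , 1) , a1) ∷ (a1 , (2 , 1 , 0) , a2) ∷ (a2 , (1 , 1 , 1) , a0) ∷
       (a2 , (1 , 1 , 1) , a1) ∷ (a2 , (1 , 2 , 0) , a0) ∷ (a2 , (2 , 1 , 0) , a1) ∷
       (a2 , (2 , 1 , 0) , a2) ∷ (□ , (1 , 1 , 1) , a0) ∷ [])
  ∷ (a0 ∷ a2 ∷ a0 ∷ a1 ∷ a0 ∷ a2 ∷ a0 ∷ a1 ∷ a0 ∷ [] ,
       (a0 , (0 , 1 , 2) , a0) ∷ (a0 , (1 , 0 , 2) , a0) ∷ (a0 , (1 , 0 , 2) , a1) ∷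
       (a0 , (1 , 1 , 1) , a0) ∷ (a0 , (1 , 1 , 1) , a1) ∷ (a0 , (1 , 1 , 1) , a2) ∷
       (a1 , (1 , 0 , 2) , a0) ∷ (a1 , (1 , 0 , 2) , a1) ∷ (a1 , (1 , 1 , 1) , a0) ∷
       (a1 , (2 , 0 , 1) , a1) ∷ (a1 , (2 , 0 , 1) , a2) ∷ (a2 , (1 , 1 , 1) , a0) ∷
       (a2 , (2 , 0 , 1) , a1) ∷ (a2 , (2 , 1 , 0) , a2) ∷ (□ , (1 , 1 , 1) , a0) ∷ [])
  ∷ (a1 ∷ a0 ∷ a0 ∷ a1 ∷ a0 ∷ a2 ∷ a0 ∷ a1 ∷ a0 ∷ [] ,
       (a0 , (0 , 0 , 3) , a0) ∷ (a0 , (0 , 1 , 2) , a0) ∷ (a0 , (0 , 2 , 1) , a0) ∷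
       (a0 , (1 , 0 , 2) , a0) ∷ (a0 , (1 , 0 , 2) , a1) ∷ (a0 , (1 , 0 , 2) , a2) ∷
       (a0 , (1 , 1 , 1) , a0) ∷ (a0 , (1 , 1 , 1) , a1) ∷ (a0 , (1 , 1 , 1) , a2) ∷
       (a1 , (1 , 0 , 2) , a0) ∷ (a1 , (1 , 0 , 2) , a1) ∷ (a1 , (1 , 0 , 2) , a2) ∷
       (a1 , (1 , 1 , 1) , a0) ∷ (a1 , (1 , 1 , 1) , a2) ∷ (a1 , (2 , 0 , 1) , a1) ∷
       (a1 , (2 , 0 , 1) , a2) ∷ (a2 , (1 , 0 , 2) , a0) ∷ (a2 , (1 , 0 , 2) , a1) ∷
       (a2 , (1 , 1 , 1) , a0) ∷ (a2 , (1 , 1 , 1) , a1) ∷ (a2 , (1 , 1 , 1) , a2) ∷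
       (a2 , (2 , 0 , 1) , a1) ∷ (a2 , (2 , 1 , 0) , a2) ∷ (□ , (1 , 1 , 1) , a0) ∷ [])
  ∷ (a1 ∷ a0 ∷ a1 ∷ a0 ∷ a2 ∷ a0 ∷ a1 ∷ a0 ∷ a0 ∷ [] ,
       (a0 , (0 , 0 , 3) , a0) ∷ (a0 , (0 , 1 , 2) , a0) ∷ (a0 , (0 , 1 , 2) , a1) ∷
       (a0 , (0 , 2 , 1) , a0) ∷ (a0 , (1 , 0 , 2) , a1) ∷ (a0 , (1 , 1 , 1) , a0) ∷
       (a0 , (1 , 1 , 1) , a1) ∷ (a0 , (1 , 1 , 1) , a2) ∷ (a1 , (0 , 1 , 2) , a0) ∷
       (a1 , (1 , 0 , 2) , a0) ∷ (a1 , (1 , 0 , 2) , a1) ∷ (a1 , (1 , 0 , 2) , a2) ∷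
       (a1 , (1 , 1 , 1) , a0) ∷ (a1 , (1 , 1 , 1) , a2) ∷ (a1 , (2 , 0 , 1) , a1) ∷
       (a2 , (1 , 0 , 2) , a1) ∷ (a2 , (1 , 1 , 1) , a0) ∷ (a2 , (1 , 1 , 1) , a1) ∷
       (a2 , (1 , 1 , 1) , a2) ∷ (□ , (1 , 1 , 1) , a2) ∷ [])
  ∷ (a1 ∷ a0 ∷ a2 ∷ a0 ∷ a1 ∷ a0 ∷ a0 ∷ a1 ∷ a0 ∷ [] ,
       (a0 , (0 , 1 , 2) , a0) ∷ (a0 , (0 , 2 , 1) , a0) ∷ (a0 , (0 , 3 , 0) , a0) ∷
       (a0 , (1 , 1 , 1) , a0) ∷ (a0 , (1 , 1 , 1) , a1) ∷ (a0 , (1 , 1 , 1) , a2) ∷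
       (a0 , (1 , 2 , 0) , a0) ∷ (a0 , (1 , 2 , 0) , a1) ∷ (a0 , (1 , 2 , 0) , a2) ∷
       (a1 , (1 , 0 , 2) , a1) ∷ (a1 , (1 , 1 , 1) , a0) ∷ (a1 , (1 , 1 , 1) , a1) ∷
       (a1 , (1 , 1 , 1) , a2) ∷ (a1 , (1 , 2 , 0) , a0) ∷ (a1 , (1 , 2 , 0) , a2) ∷
       (a1 , (2 , 1 , 0) , a1) ∷ (a1 , (2 , 1 , 0) , a2) ∷ (a2 , (1 , 1 , 1) , a0) ∷
       (a2 , (1 , 1 , 1) , a1) ∷ (a2 , (1 , 2 , 0) , a0) ∷ (a2 , (1 , 2 , 0) , a1) ∷
       (a2 , (1 , 2 , 0) , a2) ∷ (a2 , (2 , 1 , 0) , a1) ∷ (□ , (1 , 1 , 1) , a1) ∷ [])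
  ∷ (a1 ∷ a0 ∷ a2 ∷ a0 ∷ a1 ∷ a0 ∷ a1 ∷ a0 ∷ a2 ∷ [] ,
       (a0 , (0 , 1 , 2) , a0) ∷ (a0 , (0 , 1 , 2) , a1) ∷ (a0 , (0 , 2 , 1) , a0) ∷
       (a0 , (0 , 2 , 1) , a1) ∷ (a0 , (0 , 2 , 1) , a2) ∷ (a0 , (0 , 3 , 0) , a0) ∷
       (a0 , (1 , 1 , 1) , a1) ∷ (a0 , (1 , 2 , 0) , a1) ∷ (a0 , (1 , 2 , 0) , a2) ∷
       (a1 , (0 , 1 , 2) , a0) ∷ (a1 , (0 , 2 , 1) , a0) ∷ (a1 , (1 , 1 , 1) , a0) ∷
       (a1 , (1 , 1 , 1) , a1) ∷ (a1 , (1 , 1 , 1) , a2) ∷ (a1 , (1 , 2 , 0) , a0) ∷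
       (a1 , (1 , 2 , 0) , a2) ∷ (a2 , (0 , 2 , 1) , a0) ∷ (a2 , (1 , 1 , 1) , a1) ∷
       (a2 , (1 , 2 , 0) , a0) ∷ (a2 , (1 , 2 , 0) , a1) ∷ (a2 , (1 , 2 , 0) , a2) ∷ (□ , (1 , 1 , 1) , a1) ∷ [])
  ∷ (a1 ∷ a0 ∷ a2 ∷ a0 ∷ a1 ∷ a0 ∷ a2 ∷ a0 ∷ a1 ∷ [] ,
       (a0 , (0 , 1 , 2) , a0) ∷ (a0 , (0 , 1 , 2) , a1) ∷ (a0 , (0 , 2 , 1) , a0) ∷
       (a0 , (0 , 2 , 1) , a2) ∷ (a0 , (1 , 1 , 1) , a1) ∷ (a0 , (1 , 1 , 1) , a2) ∷
       (a0 , (1 , 2 , 0) , a2) ∷ (a1 , (0 , 1 , 2) , a0) ∷ (a1 , (1 , 0 , 2) , a1) ∷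
       (a1 , (1 , 1 , 1) , a0) ∷ (a1 , (1 , 1 , 1) , a1) ∷ (a1 , (1 , 1 , 1) , a2) ∷
       (a2 , (0 , 2 , 1) , a0) ∷ (a2 , (1 , 1 , 1) , a0) ∷ (a2 , (1 , 1 , 1) , a1) ∷
       (a2 , (1 , 2 , 0) , a0) ∷ (a2 , (1 , 2 , 0) , a2) ∷ (□ , (1 , 1 , 1) , a1) ∷ [])
  ∷ (a2 ∷ a0 ∷ a1 ∷ a0 ∷ a0 ∷ a1 ∷ a0 ∷ a2 ∷ a0 ∷ [] ,
       (a0 , (0 , 1 , 2) , a0) ∷ (a0 , (0 , 2 , 1) , a0) ∷ (a0 , (1 , 0 , 2) , a1) ∷
       (a0 , (1 , 1 , 1) , a0) ∷ (a0 , (1 , 1 , 1) , a1) ∷ (a0 , (1 , 1 , 1) , a2) ∷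
       (a0 , (1 , 2 , 0) , a0) ∷ (a0 , (1 , 2 , 0) , a2) ∷ (a1 , (1 , 0 , 2) , a0) ∷
       (a1 , (1 , 0 , 2) , a1) ∷ (a1 , (1 , 1 , 1) , a0) ∷ (a1 , (1 , 1 , 1) , a1) ∷
       (a1 , (1 , 1 , 1) , a2) ∷ (a1 , (2 , 0 , 1) , a1) ∷ (a1 , (2 , 1 , 0) , a2) ∷
       (a2 , (1 , 1 , 1) , a0) ∷ (a2 , (1 , 1 , 1) , a1) ∷ (a2 , (1 , 1 , 1) , a2) ∷
       (a2 , (1 , 2 , 0) , a0) ∷ (a2 , (1 , 2 , 0) , a2) ∷ (a2 , (2 , 1 , 0) , a1) ∷
       (a2 , (2 , 1 , 0) , a2) ∷ (□ , (1 , 1 , 1) , a0) ∷ [])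
  ∷ (a2 ∷ a0 ∷ a1 ∷ a0 ∷ a1 ∷ a0 ∷ a2 ∷ a0 ∷ a1 ∷ [] ,
       (a0 , (0 , 1 , 2) , a0) ∷ (a0 , (0 , 1 , 2) , a1) ∷ (a0 , (0 , 2 , 1) , a0) ∷
       (a0 , (0 , 2 , 1) , a2) ∷ (a0 , (1 , 1 , 1) , a0) ∷ (a0 , (1 , 1 , 1) , a1) ∷
       (a0 , (1 , 1 , 1) , a2) ∷ (a0 , (1 , 2 , 0) , a2) ∷ (a1 , (0 , 1 , 2) , a0) ∷
       (a1 , (1 , 0 , 2) , a1) ∷ (a1 , (1 , 1 , 1) , a0) ∷ (a1 , (1 , 1 , 1) , a1) ∷
       (a1 , (1 , 1 , 1) , a2) ∷ (a2 , (0 , 2 , 1) , a0) ∷ (a2 , (1 , 1 , 1) , a0) ∷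
       (a2 , (1 , 1 , 1) , a1) ∷ (a2 , (1 , 1 , 1) , a2) ∷ (a2 , (1 , 2 , 0) , a0) ∷
       (a2 , (1 , 2 , 0) , a2) ∷ (□ , (1 , 1 , 1) , a1) ∷ [])
  ∷ (a2 ∷ a0 ∷ a1 ∷ a0 ∷ a2 ∷ a0 ∷ a1 ∷ a0 ∷ a0 ∷ [] ,
       (a0 , (0 , 1 , 2) , a0) ∷ (a0 , (0 , 1 , 2) , a1) ∷ (a0 , (0 , 2 , 1) , a0) ∷
       (a0 , (1 , 0 , 2) , a1) ∷ (a0 , (1 , 1 , 1) , a0) ∷ (a0 , (1 , 1 , 1) , a1) ∷
       (a0 , (1 , 1 , 1) , a2) ∷ (a1 , (0 , 1 , 2) , a0) ∷ (a1 , (1 , 0 , 2) , a0) ∷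
       (a1 , (1 , 0 , 2) , a1) ∷ (a1 , (1 , 1 , 1) , a0) ∷ (a1 , (1 , 1 , 1) , a1) ∷
       (a1 , (1 , 1 , 1) , a2) ∷ (a2 , (1 , 1 , 1) , a0) ∷ (a2 , (1 , 1 , 1) , a1) ∷
       (a2 , (1 , 1 , 1) , a2) ∷ (□ , (1 , 1 , 1) , a2) ∷ [])
  ∷ (□ ∷ a0 ∷ a1 ∷ a0 ∷ a2 ∷ a0 ∷ a1 ∷ a0 ∷ a0 ∷ [] ,
       (a0 , (0 , 1 , 2) , a0) ∷ (a0 , (0 , 2 , 1) , a0) ∷ (a0 , (1 , 1 , 1) , a1) ∷
       (a0 , (1 , 1 , 1) , a2) ∷ (a1 , (1 , 0 , 2) , a1) ∷ (a1 , (1 , 1 , 1) , a0) ∷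
       (a1 , (1 , 1 , 1) , a2) ∷ (a2 , (1 , 1 , 1) , a0) ∷ (a2 , (1 , 1 , 1) , a1) ∷
       (a2 , (1 , 1 , 1) , a2) ∷ (□ , (1 , 1 , 1) , a2) ∷ [])
  ∷ (□ ∷ □ ∷ a0 ∷ a1 ∷ a0 ∷ a2 ∷ a0 ∷ a1 ∷ a0 ∷ [] ,
       (a0 , (1 , 0 , 2) , a1) ∷ (a0 , (1 , 1 , 1) , a0) ∷ (a0 , (1 , 1 , 1) , a1) ∷
       (a0 , (1 , 1 , 1) , a2) ∷ (a1 , (1 , 0 , 2) , a0) ∷ (a1 , (1 , 1 , 1) , a0) ∷
       (a1 , (2 , 0 , 1) , a1) ∷ (a2 , (1 , 1 , 1) , a0) ∷ (□ , (1 , 1 , 1) , a0) ∷ [])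
  ∷ (□ ∷ □ ∷ □ ∷ a0 ∷ a1 ∷ a0 ∷ a2 ∷ a0 ∷ a1 ∷ [] ,
       (a0 , (0 , 1 , 2) , a0) ∷ (a0 , (0 , 2 , 1) , a0) ∷ (a0 , (1 , 1 , 1) , a1) ∷
       (a1 , (1 , 1 , 1) , a0) ∷ (a1 , (1 , 1 , 1) , a1) ∷ (a1 , (1 , 1 , 1) , a2) ∷
       (a2 , (1 , 1 , 1) , a1) ∷ (□ , (1 , 1 , 1) , a1) ∷ [])
  ∷ (□ ∷ □ ∷ □ ∷ □ ∷ a0 ∷ a1 ∷ a0 ∷ a2 ∷ a0 ∷ [] ,
       (a0 , (1 , 1 , 1) , a0) ∷ (a0 , (1 , 1 , 1) , a1) ∷ (a0 , (1 , 1 , 1) , a2) ∷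
       (a1 , (1 , 1 , 1) , a0) ∷ (a2 , (1 , 1 , 1) , a0) ∷ (□ , (1 , 1 , 1) , a0) ∷ [])
  ∷ []

closedStep : List Sym → State → Bool → Bool → Bool
closedStep c s a b with guard? a (proj₁ s) ×-dec guard? b (proj₂ (proj₂ s))
... | no _ = true
... | yes _ with step? c 0 s a b
...   | nothing = false
...   | just st = isYes (childState st ∈? entries reachableStates (childContext st))

closedStep-sound : ∀ c s a b → T (closedStep c s a b) → Guard a (proj₁ s) → Guard b (proj₂ (proj₂ s)) →
                   Σ[ st ∈ Step c 0 s a b ] childState st ∈ entries reachableStates (childContext st)
closedStep-sound c s a b ok g₁ g₂ with guard? a (proj₁ s) ×-dec guard? b (proj₂ (proj₂ s))
... | no ¬g = ⊥-elim (¬g (g₁ , g₂))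
... | yes _ with step? c 0 s a b
...   | nothing = ⊥-elim ok
...   | just st = st , toWitness ok

opaque
  closedEntry : List Sym × List State → Bool
  closedEntry (c , ss) = all (λ s → all (uncurry (closedStep c s)) flags) ss

opaque
  unfolding closedEntry

  reachableStates-closed : T (all closedEntry reachableStates)
  reachableStates-closed = _

  closedEntry-sound : ∀ {c s} → s ∈ entries reachableStates c → T (closedEntry (c , entries reachableStates c)) →
                      ∀ a b → T (closedStep c s a b)
  closedEntry-sound {c} {s} s∈ ok a b =
    All.lookup (all⁺ (uncurry (closedStep c s)) flags (All.lookup (all⁺ (λ s → all (uncurry (closedStep c s)) flags) _ ok) s∈))
      (flags-complete a b)

closed-at : ∀ {c s} → s ∈ entries reachableStates c → ∀ a b → T (closedStep c s a b)
closed-at {c} s∈ = closedEntry-sound s∈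
  (All.lookup (all⁺ closedEntry reachableStates reachableStates-closed) (entries-key reachableStates c s∈))

initialPairs : List (Sym × Sym)
initialPairs = (□ , a0) ∷ (a0 , a0) ∷ (a0 , a1) ∷ (a0 , a2) ∷ (a1 , a0) ∷ (a2 , a0) ∷ []

initial-pair : ∀ i → (before i , padded (4 + i)) ∈ initialPairs
initial-pair zero = here refl
initial-pair (suc i) with inBlock-exists i
... | false , q , ib = subst (λ x → (x , padded (5 + i)) ∈ initialPairs) (sym (letter-inBlock ib)) (after-a0 (t (suc i)))
  where
  after-a0 : ∀ x → (a0 , just x) ∈ initialPairs
  after-a0 zero = there (here refl)
  after-a0 (suc zero) = there (there (here refl))
  after-a0 (suc (suc zero)) = there (there (there (here refl)))
... | true , q , ib@(second _ long) =
  subst₂ (λ x y → (x , y) ∈ initialPairs) (sym (letter-inBlock ib)) (sym (letter-inBlock (second-then-first ib)))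
    (last-a0 (padded (4 + q)) long)
  where
  last-a0 : ∀ s → LongBlock s → (lastσ s , a0) ∈ initialPairs
  last-a0 a0 _ = there (there (there (there (here refl))))
  last-a0 a1 _ = there (there (there (there (there (here refl)))))
  last-a0 a2 ()
  last-a0 □ ()

initialIn : Sym × Sym → Bool
initialIn (x , y) = isYes ((x , 𝟙 , y) ∈? entries reachableStates (ctx 0))

initial-reachable : T (all initialIn initialPairs)
initial-reachable = _

reachable : ∀ i n → ∃[ s ] (s ∈ entries reachableStates (ctx n) × HasState i n s)
reachable i n = go (suc (i + n)) i n ≤-refl
  where
  go : ∀ B i n → i + n < B → ∃[ s ] (s ∈ entries reachableStates (ctx n) × HasState i n s)
  go (suc B) i zero _ =
    (before i , 𝟙 , padded (4 + i)) ,
    toWitness (All.lookup (all⁺ initialIn initialPairs initial-reachable) (initial-pair i)) ,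
    hasState refl refl (cong padded (+-identityʳ (4 + i)))
  go (suc B) i (suc n) (s≤s i+n<B) with desubstitute i (suc n) (s≤s z≤n)
  ... | record { a = a ; b = b ; j = j ; m = m ; start = start ; end = end ; shorter = shorter }
    with s , s∈ , has ← go B j m (≤-trans shorter i+n<B)
    = let st , child∈ = closedStep-sound (ctx m) s a b (closed-at s∈ a b)
                          (subst (Guard a) (HasState.before-eq has) (guard-start start))
                          (subst (Guard b) (HasState.after-eq has) (guard-inBlock end))
      in childState st ,
         subst (λ c → childState st ∈ entries reachableStates c) (sym (step-context has start end (+-identityʳ m) st)) child∈ ,
         step-state has start end (+-identityʳ m) st

-- Occurrences at bounded positions

record Alike (i i' n : ℕ) : Set where
  field
    before≡ : before i' ≡ before i
    parikh≡ : parikh (factor i' n) ≡ parikh (factor i n)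
    after≡ : padded (4 + i' + n) ≡ padded (4 + i + n)

hasState-alike : ∀ {i i' n s} → HasState i n s → HasState i' n s → Alike i i' n
hasState-alike h h' = record
  { before≡ = trans (HasState.before-eq h') (sym (HasState.before-eq h))
  ; parikh≡ = ⊕-cancelʳ _ _ 𝟙 (trans (HasState.excess-eq h') (sym (HasState.excess-eq h)))
  ; after≡ = trans (HasState.after-eq h') (sym (HasState.after-eq h))
  }

alike-desubst : ∀ {a b j j' m i i' n n'} → StartsAt a j i → InBlock b (j + m) (i + n) →
                StartsAt a j' i' → InBlock b (j' + m) (i' + n') → Alike j j' m → n' ≡ n × Alike i i' n
alike-desubst {a} {b} {j} {j'} {m} {i} {i'} {n} {n'} start end start' end' alike = n'≡n , record
  { before≡ = trans (before-start start') (trans (cong (newBefore a) (Alike.before≡ alike)) (sym (before-start start)))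
  ; parikh≡ = begin
      parikh (factor i' n)                                     ≡⟨ cong (parikh ∘ factor i') (sym n'≡n) ⟩
      parikh (factor i' n')                                    ≡⟨ parikh-desubst start' end' ⟩
      headExtra a (before j') ⊕ M (parikh (factor j' m)) ⊕ tailExtra b
        ≡⟨ cong₂ (λ x p → headExtra a x ⊕ M p ⊕ tailExtra b) (Alike.before≡ alike) (Alike.parikh≡ alike) ⟩
      headExtra a (before j) ⊕ M (parikh (factor j m)) ⊕ tailExtra b ≡⟨ sym (parikh-desubst start end) ⟩
      parikh (factor i n)                                      ∎
  ; after≡ = begin
      padded (4 + i' + n)                  ≡⟨ cong (λ l → padded (4 + i' + l)) (sym n'≡n) ⟩
      padded (4 + (i' + n'))               ≡⟨ letter-inBlock end' ⟩
      newAfter b (padded (4 + j' + m))     ≡⟨ cong (newAfter b) (Alike.after≡ alike) ⟩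
      newAfter b (padded (4 + j + m))      ≡⟨ sym (letter-inBlock end) ⟩
      padded (4 + (i + n))                 ∎
  }
  where
  open ≡-Reasoning
  n'≡n : n' ≡ n
  n'≡n = trans (length-desubst start' end')
           (trans (cong (λ p → m + ∣ p ∣₀ + ∣ p ∣₁ + bit a + bit b) (Alike.parikh≡ alike)) (sym (length-desubst start end)))

-- Undoing one desubstitution step at most doubles a position (blockPos Q ≤ 2 Q), and the positions
-- below 20 already realize every state of length 0 and 1.
positionBound : ℕ → ℕ
positionBound zero = 20
positionBound (suc n) = 2 * positionBound n + 20

positionBound-mono : ∀ {m n} → m ≤ n → positionBound m ≤ positionBound n
positionBound-mono {m} {n} m≤n with o , refl ← m≤n⇒∃[o]m+o≡n m≤n = go o
  where
  go : ∀ o → positionBound m ≤ positionBound (m + o)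
  go zero = ≤-reflexive (cong positionBound (sym (+-identityʳ m)))
  go (suc o) = ≤-trans (go o) (≤-trans (≤-trans (m≤m+n _ _) (m≤m+n _ 20)) (≤-reflexive (cong positionBound (sym (+-suc m o)))))

blockPos-≤ : ∀ Q → blockPos Q ≤ 2 * Q
blockPos-≤ zero = z≤n
blockPos-≤ (suc Q) = ≤-trans (+-mono-≤ (blockPos-≤ Q) (length-σ-≤2 (padded Q))) (≤-reflexive (lemma Q))
  where
  lemma : ∀ Q → 2 * Q + 2 ≡ 2 * suc Q
  lemma = solve-∀

after-two : ∀ j → padded (4 + j) ≡ a2 → padded (5 + j) ≡ a0
after-two j eq with inBlock-exists j
... | false , q , ib with () ← trans (sym (letter-inBlock ib)) eq
... | true , q , ib = letter-inBlock (second-then-first ib)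

contains-0-or-1 : ∀ j m → 1 ≤ ∣ parikh (factor j (2 + m)) ∣₀ + ∣ parikh (factor j (2 + m)) ∣₁
contains-0-or-1 j m =
  subst (λ v → 1 ≤ ∣ v ∣₀ + ∣ v ∣₁) (sym (trans (parikh-∷ (t (j + 0)) _) (cong (unit (just (t (j + 0))) ⊕_) (parikh-∷ (t (j + 1)) rest))))
    (go (t (j + 0)) (t (j + 1)) (parikh rest) refl refl)
  where
  rest = map (λ k → t (j + k)) (applyUpTo (λ k → suc (suc k)) m)
  go : ∀ x y R → t (j + 0) ≡ x → t (j + 1) ≡ y → 1 ≤ ∣ unit (just x) ⊕ (unit (just y) ⊕ R) ∣₀ + ∣ unit (just x) ⊕ (unit (just y) ⊕ R) ∣₁
  go zero y R _ _ = s≤s z≤n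
  go (suc zero) y R _ _ = ≤-trans (s≤s z≤n) (m≤n+m _ _)
  go (suc (suc zero)) zero R _ _ = s≤s z≤n
  go (suc (suc zero)) (suc zero) R _ _ = ≤-trans (s≤s z≤n) (m≤n+m _ _)
  go (suc (suc zero)) (suc (suc zero)) R tj tj+1 with () ← trans (sym (cong just (trans (cong t (+-comm 1 j)) tj+1)))
    (after-two j (cong just (trans (cong t (sym (+-identityʳ j))) tj)))

desubst-shorter : ∀ {a b j m i n} → StartsAt a j i → InBlock b (j + m) (i + n) → 2 ≤ n → m < n
desubst-shorter {m = zero} _ _ 2≤n = ≤-trans (s≤s z≤n) 2≤n
desubst-shorter {m = suc zero} _ _ 2≤n = 2≤n
desubst-shorter {a} {b} {j} {suc (suc m)} start end _ =
  subst (3 + m ≤_) (sym (length-desubst start end)) (lemma (2 + m) _ _ (bit a) (bit b) (contains-0-or-1 j m))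
  where
  lemma : ∀ k p q x y → 1 ≤ p + q → suc k ≤ k + p + q + x + y
  lemma k p q x y 1≤ = ≤-trans (≤-trans (≤-reflexive (+-comm 1 k)) (≤-trans (+-monoʳ-≤ k 1≤) (≤-reflexive (sym (+-assoc k p q)))))
                         (≤-trans (m≤m+n _ x) (m≤m+n _ y))

witnessedBelow : ℕ → State → Bool
witnessedBelow n s = any (λ i → isYes (hasState? i n s)) (upTo (positionBound n))

opaque
  witnessedAt : ℕ → Bool
  witnessedAt n = all (witnessedBelow n) (entries reachableStates (ctx n))

opaque
  unfolding witnessedAt

  short-witnessed : T (witnessedAt 0) × T (witnessedAt 1)
  short-witnessed = _

  witnessedAt-sound : ∀ {n s} → T (witnessedAt n) → s ∈ entries reachableStates (ctx n) →
                      ∃[ i ] (i < positionBound n × HasState i n s)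
  witnessedAt-sound {n} {s} ok s∈
    with i , i∈ , has ← find (any⁻ (λ i → isYes (hasState? i n s)) (upTo (positionBound n))
                                (All.lookup (all⁺ (witnessedBelow n) (entries reachableStates (ctx n)) ok) s∈)) =
    i , ∈-upTo⁻ i∈ , toWitness has

alike-below : ∀ n i → ∃[ i' ] (i' < positionBound n × Alike i i' n)
alike-below n = go (suc n) n ≤-refl
  where
  short : ∀ n i → T (witnessedAt n) → ∃[ i' ] (i' < positionBound n × Alike i i' n)
  short n i ok =
    let s , s∈ , has = reachable i n
        i' , i'< , has' = witnessedAt-sound ok s∈
    in i' , i'< , hasState-alike has has'
  go : ∀ C n → n < C → ∀ i → ∃[ i' ] (i' < positionBound n × Alike i i' n)
  go (suc C) zero _ i = short 0 i (proj₁ short-witnessed)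
  go (suc C) (suc zero) _ i = short 1 i (proj₂ short-witnessed)
  go (suc C) n@(suc (suc _)) (s≤s n≤C) i with desubstitute i n (s≤s z≤n)
  ... | record { a = a ; b = b ; j = j ; m = m ; start = start ; end = end } =
    let m<n = desubst-shorter start end (s≤s (s≤s z≤n))
        j' , j'< , alike = go C m (≤-trans m<n n≤C) j
        i' , start' = startsAt-guarded a j' (subst (Guard a) (sym (Alike.before≡ alike)) (guard-start start))
        _ , end' = endsAt-guarded b m start' (subst (Guard b) (sym (Alike.after≡ alike)) (guard-inBlock end))
        _ , alike' = alike-desubst start end start' end' alike
    in i' , bound j' i' (start-pos start') m<n j'< , alike'
    where
    bound : ∀ j' i' → 4 + i' + bit a ≡ blockPos (4 + j') → m < n → j' < positionBound m → i' < positionBound n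
    bound j' i' pos m<n j'< = begin-strict
      i'                     ≤⟨ m≤n+m i' 4 ⟩
      4 + i'                 ≤⟨ m≤m+n (4 + i') (bit a) ⟩
      4 + i' + bit a         ≡⟨ pos ⟩
      blockPos (4 + j')      ≤⟨ blockPos-≤ (4 + j') ⟩
      2 * (4 + j')           <⟨ lemma j' (positionBound m) j'< ⟩
      2 * positionBound m + 20 ≤⟨ positionBound-mono m<n ⟩
      positionBound n        ∎
      where
      open ≤-Reasoning
      lemma : ∀ x y → x < y → 2 * (4 + x) < 2 * y + 20
      lemma x y x<y = ≤-trans (≤-reflexive (lemma′ x)) (+-mono-≤ (*-monoʳ-≤ 2 x<y) (s≤s (s≤s (s≤s (s≤s (s≤s (s≤s (s≤s z≤n))))))))
        where
        lemma′ : ∀ x → suc (2 * (4 + x)) ≡ 2 * suc x + 7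
        lemma′ = solve-∀

-- An entry (β , s) at c claims that s is the state of some factor of length k ∸ β whenever ctx k = c;
-- each claim is justified by an entry at the context from which ctx k arises by desubstitution.
realizedStates : Table (ℕ × State)
realizedStates =
    (a0 ∷ a0 ∷ a1 ∷ a0 ∷ a2 ∷ a0 ∷ a1 ∷ a0 ∷ a0 ∷ [] ,
       (0 , (a0 , (0 , 1 , 2) , a0)) ∷ (0 , (a0 , (0 , 2 , 1) , a0)) ∷ (0 , (a0 , (1 , 1 , 1) , a1)) ∷
       (1 , (a0 , (0 , 1 , 2) , a0)) ∷ (1 , (a0 , (1 , 0 , 2) , a1)) ∷ (1 , (a1 , (1 , 1 , 1) , a0)) ∷ [])
  ∷ (a0 ∷ a0 ∷ a1 ∷ a0 ∷ a2 ∷ a0 ∷ a1 ∷ a0 ∷ a1 ∷ [] ,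
       (0 , (a0 , (0 , 1 , 2) , a0)) ∷ (0 , (a0 , (0 , 2 , 1) , a0)) ∷ (0 , (a0 , (1 , 1 , 1) , a1)) ∷
       (1 , (a0 , (0 , 1 , 2) , a0)) ∷ (1 , (a0 , (1 , 0 , 2) , a1)) ∷ (1 , (a1 , (1 , 1 , 1) , a0)) ∷ [])
  ∷ (a0 ∷ a0 ∷ a1 ∷ a0 ∷ a2 ∷ a0 ∷ a1 ∷ a0 ∷ a2 ∷ [] ,
       (0 , (a0 , (0 , 1 , 2) , a0)) ∷ (0 , (a0 , (0 , 2 , 1) , a0)) ∷ (0 , (a0 , (1 , 1 , 1) , a1)) ∷
       (1 , (a0 , (0 , 1 , 2) , a0)) ∷ (1 , (a0 , (1 , 0 , 2) , a1)) ∷ (1 , (a1 , (1 , 1 , 1) , a0)) ∷ [])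
  ∷ (a0 ∷ a1 ∷ a0 ∷ a0 ∷ a1 ∷ a0 ∷ a2 ∷ a0 ∷ a1 ∷ [] ,
       (0 , (a0 , (0 , 1 , 2) , a0)) ∷ (0 , (a0 , (0 , 2 , 1) , a0)) ∷ (0 , (a0 , (1 , 1 , 1) , a1)) ∷
       (0 , (a1 , (0 , 1 , 2) , a0)) ∷ (1 , (a0 , (0 , 1 , 2) , a0)) ∷ (1 , (a0 , (0 , 2 , 1) , a0)) ∷ [])
  ∷ (a0 ∷ a1 ∷ a0 ∷ a1 ∷ a0 ∷ a2 ∷ a0 ∷ a1 ∷ a0 ∷ [] ,
       (0 , (a0 , (1 , 0 , 2) , a0)) ∷ (0 , (a0 , (1 , 0 , 2) , a1)) ∷ (0 , (a0 , (1 , 1 , 1) , a0)) ∷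
       (0 , (a1 , (1 , 0 , 2) , a0)) ∷ (0 , (a1 , (1 , 1 , 1) , a0)) ∷ (0 , (a1 , (2 , 0 , 1) , a1)) ∷
       (1 , (a0 , (0 , 1 , 2) , a0)) ∷ (1 , (a0 , (1 , 1 , 1) , a1)) ∷ [])
  ∷ (a0 ∷ a1 ∷ a0 ∷ a2 ∷ a0 ∷ a1 ∷ a0 ∷ a0 ∷ a1 ∷ [] ,
       (0 , (a0 , (1 , 1 , 1) , a0)) ∷ (0 , (a0 , (1 , 2 , 0) , a0)) ∷ (0 , (a1 , (1 , 1 , 1) , a0)) ∷
       (0 , (a1 , (2 , 1 , 0) , a2)) ∷ (0 , (a2 , (1 , 1 , 1) , a0)) ∷ (1 , (a0 , (0 , 2 , 1) , a0)) ∷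
       (1 , (a0 , (1 , 1 , 1) , a1)) ∷ [])
  ∷ (a0 ∷ a1 ∷ a0 ∷ a2 ∷ a0 ∷ a1 ∷ a0 ∷ a1 ∷ a0 ∷ [] ,
       (0 , (a0 , (0 , 2 , 1) , a0)) ∷ (0 , (a0 , (1 , 1 , 1) , a0)) ∷ (0 , (a0 , (1 , 2 , 0) , a0)) ∷
       (0 , (a2 , (1 , 1 , 1) , a0)) ∷ (1 , (a0 , (0 , 2 , 1) , a0)) ∷ (1 , (a0 , (1 , 1 , 1) , a1)) ∷ [])
  ∷ (a0 ∷ a1 ∷ a0 ∷ a2 ∷ a0 ∷ a1 ∷ a0 ∷ a2 ∷ a0 ∷ [] ,
       (0 , (a0 , (1 , 1 , 1) , a0)) ∷ (0 , (a0 , (1 , 2 , 0) , a0)) ∷ (0 , (a1 , (1 , 1 , 1) , a0)) ∷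
       (0 , (a1 , (2 , 1 , 0) , a2)) ∷ (0 , (a2 , (1 , 1 , 1) , a0)) ∷ (1 , (a0 , (0 , 2 , 1) , a0)) ∷
       (1 , (a0 , (1 , 1 , 1) , a1)) ∷ [])
  ∷ (a0 ∷ a2 ∷ a0 ∷ a1 ∷ a0 ∷ a0 ∷ a1 ∷ a0 ∷ a2 ∷ [] ,
       (0 , (a0 , (1 , 0 , 2) , a1)) ∷ (0 , (a0 , (1 , 1 , 1) , a0)) ∷ (0 , (a1 , (1 , 0 , 2) , a0)) ∷
       (0 , (a1 , (1 , 1 , 1) , a0)) ∷ (0 , (a1 , (2 , 0 , 1) , a1)) ∷ (1 , (a0 , (0 , 1 , 2) , a0)) ∷
       (1 , (a0 , (1 , 1 , 1) , a1)) ∷ (1 , (a0 , (1 , 2 , 0) , a2)) ∷ [])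
  ∷ (a0 ∷ a2 ∷ a0 ∷ a1 ∷ a0 ∷ a1 ∷ a0 ∷ a2 ∷ a0 ∷ [] ,
       (0 , (a0 , (1 , 0 , 2) , a1)) ∷ (0 , (a0 , (1 , 1 , 1) , a0)) ∷ (0 , (a1 , (1 , 0 , 2) , a0)) ∷
       (0 , (a1 , (1 , 1 , 1) , a0)) ∷ (0 , (a1 , (2 , 0 , 1) , a1)) ∷ (1 , (a0 , (0 , 1 , 2) , a0)) ∷
       (1 , (a0 , (1 , 1 , 1) , a1)) ∷ [])
  ∷ (a0 ∷ a2 ∷ a0 ∷ a1 ∷ a0 ∷ a2 ∷ a0 ∷ a1 ∷ a0 ∷ [] ,
       (0 , (a0 , (1 , 0 , 2) , a1)) ∷ (0 , (a0 , (1 , 1 , 1) , a0)) ∷ (0 , (a1 , (1 , 0 , 2) , a0)) ∷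
       (0 , (a1 , (1 , 1 , 1) , a0)) ∷ (0 , (a1 , (2 , 0 , 1) , a1)) ∷ (1 , (a0 , (0 , 1 , 2) , a0)) ∷
       (1 , (a0 , (1 , 1 , 1) , a1)) ∷ [])
  ∷ (a1 ∷ a0 ∷ a0 ∷ a1 ∷ a0 ∷ a2 ∷ a0 ∷ a1 ∷ a0 ∷ [] ,
       (0 , (a0 , (0 , 1 , 2) , a0)) ∷ (0 , (a0 , (1 , 0 , 2) , a1)) ∷ (0 , (a0 , (1 , 1 , 1) , a0)) ∷
       (0 , (a1 , (1 , 1 , 1) , a0)) ∷ (1 , (a0 , (0 , 1 , 2) , a0)) ∷ (1 , (a0 , (1 , 1 , 1) , a1)) ∷ [])
  ∷ (a1 ∷ a0 ∷ a1 ∷ a0 ∷ a2 ∷ a0 ∷ a1 ∷ a0 ∷ a0 ∷ [] ,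
       (0 , (a0 , (0 , 1 , 2) , a0)) ∷ (0 , (a0 , (0 , 2 , 1) , a0)) ∷ (0 , (a0 , (1 , 0 , 2) , a1)) ∷
       (0 , (a0 , (1 , 1 , 1) , a1)) ∷ (1 , (a0 , (1 , 0 , 2) , a1)) ∷ (1 , (a1 , (1 , 0 , 2) , a0)) ∷
       (1 , (a1 , (1 , 1 , 1) , a0)) ∷ [])
  ∷ (a1 ∷ a0 ∷ a2 ∷ a0 ∷ a1 ∷ a0 ∷ a0 ∷ a1 ∷ a0 ∷ [] ,
       (0 , (a0 , (0 , 1 , 2) , a0)) ∷ (0 , (a0 , (0 , 2 , 1) , a0)) ∷ (0 , (a0 , (1 , 1 , 1) , a1)) ∷
       (1 , (a0 , (1 , 2 , 0) , a0)) ∷ (1 , (a1 , (1 , 1 , 1) , a0)) ∷ (1 , (a2 , (1 , 1 , 1) , a0)) ∷ [])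
  ∷ (a1 ∷ a0 ∷ a2 ∷ a0 ∷ a1 ∷ a0 ∷ a1 ∷ a0 ∷ a2 ∷ [] ,
       (0 , (a0 , (0 , 1 , 2) , a0)) ∷ (0 , (a0 , (0 , 2 , 1) , a0)) ∷ (0 , (a0 , (1 , 1 , 1) , a1)) ∷
       (1 , (a0 , (0 , 2 , 1) , a0)) ∷ (1 , (a0 , (1 , 2 , 0) , a0)) ∷ (1 , (a2 , (1 , 1 , 1) , a0)) ∷ [])
  ∷ (a1 ∷ a0 ∷ a2 ∷ a0 ∷ a1 ∷ a0 ∷ a2 ∷ a0 ∷ a1 ∷ [] ,
       (0 , (a0 , (0 , 1 , 2) , a0)) ∷ (0 , (a0 , (0 , 2 , 1) , a0)) ∷ (0 , (a0 , (1 , 1 , 1) , a1)) ∷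
       (1 , (a0 , (1 , 2 , 0) , a0)) ∷ (1 , (a1 , (1 , 1 , 1) , a0)) ∷ (1 , (a2 , (1 , 1 , 1) , a0)) ∷ [])
  ∷ (a2 ∷ a0 ∷ a1 ∷ a0 ∷ a0 ∷ a1 ∷ a0 ∷ a2 ∷ a0 ∷ [] ,
       (0 , (a0 , (0 , 1 , 2) , a0)) ∷ (0 , (a0 , (0 , 2 , 1) , a0)) ∷ (0 , (a0 , (1 , 1 , 1) , a0)) ∷
       (1 , (a1 , (1 , 0 , 2) , a0)) ∷ (1 , (a1 , (1 , 1 , 1) , a0)) ∷ [])
  ∷ (a2 ∷ a0 ∷ a1 ∷ a0 ∷ a1 ∷ a0 ∷ a2 ∷ a0 ∷ a1 ∷ [] ,
       (0 , (a0 , (0 , 1 , 2) , a0)) ∷ (0 , (a0 , (0 , 2 , 1) , a0)) ∷ (0 , (a0 , (1 , 1 , 1) , a1)) ∷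
       (1 , (a1 , (1 , 0 , 2) , a0)) ∷ (1 , (a1 , (1 , 1 , 1) , a0)) ∷ [])
  ∷ (a2 ∷ a0 ∷ a1 ∷ a0 ∷ a2 ∷ a0 ∷ a1 ∷ a0 ∷ a0 ∷ [] ,
       (0 , (a0 , (0 , 1 , 2) , a0)) ∷ (0 , (a0 , (0 , 2 , 1) , a0)) ∷ (0 , (a0 , (1 , 1 , 1) , a1)) ∷
       (1 , (a0 , (1 , 0 , 2) , a1)) ∷ (1 , (a1 , (1 , 0 , 2) , a0)) ∷ (1 , (a1 , (1 , 1 , 1) , a0)) ∷ [])
  ∷ (□ ∷ a0 ∷ a1 ∷ a0 ∷ a2 ∷ a0 ∷ a1 ∷ a0 ∷ a0 ∷ [] ,
       (0 , (a0 , (0 , 1 , 2) , a0)) ∷ (0 , (a0 , (0 , 2 , 1) , a0)) ∷ (0 , (a0 , (1 , 1 , 1) , a1)) ∷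
       (1 , (a0 , (1 , 0 , 2) , a1)) ∷ (1 , (a1 , (1 , 0 , 2) , a0)) ∷ (1 , (a1 , (1 , 1 , 1) , a0)) ∷ [])
  ∷ (□ ∷ □ ∷ a0 ∷ a1 ∷ a0 ∷ a2 ∷ a0 ∷ a1 ∷ a0 ∷ [] ,
       (0 , (a0 , (1 , 0 , 2) , a1)) ∷ (0 , (a0 , (1 , 1 , 1) , a0)) ∷ (0 , (a1 , (1 , 0 , 2) , a0)) ∷
       (0 , (a1 , (1 , 1 , 1) , a0)) ∷ (0 , (a1 , (2 , 0 , 1) , a1)) ∷ (1 , (a0 , (0 , 1 , 2) , a0)) ∷
       (1 , (a0 , (1 , 1 , 1) , a1)) ∷ [])
  ∷ (□ ∷ □ ∷ □ ∷ a0 ∷ a1 ∷ a0 ∷ a2 ∷ a0 ∷ a1 ∷ [] ,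
       (0 , (a0 , (0 , 1 , 2) , a0)) ∷ (0 , (a0 , (0 , 2 , 1) , a0)) ∷ (0 , (a0 , (1 , 1 , 1) , a1)) ∷
       (1 , (a1 , (1 , 1 , 1) , a0)) ∷ (1 , (a2 , (1 , 1 , 1) , a0)) ∷ [])
  ∷ (□ ∷ □ ∷ □ ∷ □ ∷ a0 ∷ a1 ∷ a0 ∷ a2 ∷ a0 ∷ [] ,
       (0 , (a0 , (1 , 1 , 1) , a0)) ∷ (0 , (a1 , (1 , 1 , 1) , a0)) ∷ (0 , (a2 , (1 , 1 , 1) , a0)) ∷ [])
  ∷ []

prefixImageLength : List Sym → ℕ
prefixImageLength c = length (σ* (take 4 c))

-- If c = ctx q and 4 + k = blockPos (4 + q) + a, then childKey c a = ctx k.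
childKey : List Sym → ℕ → List Sym
childKey c a = take 9 (drop (prefixImageLength c + a ∸ 4) (σ* c))

justifies : List Sym → ℕ → ℕ → State → ℕ × State → Bool × Bool → Bool
justifies c a β s (β' , s') (a' , b') with β' ≤? 1 ×-dec guard? a' (proj₁ s') ×-dec guard? b' (proj₂ (proj₂ s'))
... | no _ = false
... | yes _ with step? c β' s' a' b'
...   | nothing = false
...   | just st = isYes (childState st ≟ˢᵗ s) ∧ isYes (Step.offset st + 4 + β ≟ prefixImageLength c + a)

record Justification (c : List Sym) (a β : ℕ) (s : State) : Set where
  field
    {β'} : ℕ
    {s'} : State
    {a' b'} : Bool
    parent∈ : (β' , s') ∈ entries realizedStates c
    β'≤1 : β' ≤ 1
    guard-a : Guard a' (proj₁ s')
    guard-b : Guard b' (proj₂ (proj₂ s'))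
    step : Step c β' s' a' b'
    child≡ : childState step ≡ s
    offset≡ : Step.offset step + 4 + β ≡ prefixImageLength c + a

justifies-sound : ∀ {c a β s β' s'} a' b' → (β' , s') ∈ entries realizedStates c →
                  T (justifies c a β s (β' , s') (a' , b')) → Justification c a β s
justifies-sound {c} {a} {β} {s} {β'} {s'} a' b' p∈ ok
  with β' ≤? 1 ×-dec guard? a' (proj₁ s') ×-dec guard? b' (proj₂ (proj₂ s'))
... | no _ = ⊥-elim ok
... | yes (β'≤1 , g₁ , g₂) with step? c β' s' a' b'
...   | nothing = ⊥-elim ok
...   | just st = let ok₁ , ok₂ = Equivalence.to (T-∧ {isYes (childState st ≟ˢᵗ s)}) ok in
  record { parent∈ = p∈ ; β'≤1 = β'≤1 ; guard-a = g₁ ; guard-b = g₂ ; step = st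
         ; child≡ = toWitness ok₁ ; offset≡ = toWitness ok₂ }

justified : List Sym → ℕ → ℕ × State → Bool
justified c a (β , s) = any (λ p → any (justifies c a β s p) flags) (entries realizedStates c)

justified-sound : ∀ {c a β s} → T (justified c a (β , s)) → Justification c a β s
justified-sound {c} {a} {β} {s} ok
  with p , p∈ , ok′ ← find (any⁻ (λ p → any (justifies c a β s p) flags) (entries realizedStates c) ok)
  with (a' , b') , _ , ok″ ← find (any⁻ (justifies c a β s p) flags ok′) = justifies-sound a' b' p∈ ok″

-- Every position 4 + k with k ≥ 1 is the first letter of a block other than the first one
-- (a = 0, ctx q ≠ ctx 0) or the second letter of a long block (a = 1).
needsJustification : List Sym → ℕ → Bool
needsJustification c zero = not (isYes (c ≟ʷ ctx 0))
needsJustification c (suc zero) = isYes (longBlock? (lookupᵈ □ c 4))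
needsJustification c (suc (suc _)) = false

childrenJustified : List Sym → ℕ → Bool
childrenJustified c a with needsJustification c a
... | false = true
... | true = isYes (prefixImageLength c + a ∸ 4 + 9 ≤? length (σ* c))
             ∧ all (justified c a) (entries realizedStates (childKey c a))

baseEntry : ℕ × State → Bool
baseEntry (β , s) = isYes (β ≟ 0) ∧ witnessedBelow 0 s

opaque
  justifiedEntry : List Sym × List State → Bool
  justifiedEntry (c , _) = childrenJustified c 0 ∧ childrenJustified c 1

  baseRealized : Bool
  baseRealized = all baseEntry (entries realizedStates (ctx 0))

opaque
  unfolding justifiedEntry baseRealized

  realizedStates-checked : T (all justifiedEntry reachableStates) × T baseRealized
  realizedStates-checked = _

  justifiedEntry-sound : ∀ {c ss} → T (justifiedEntry (c , ss)) → ∀ a → a ≤ 1 → T (childrenJustified c a)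
  justifiedEntry-sound {c} ok zero _ = proj₁ (Equivalence.to (T-∧ {childrenJustified c 0}) ok)
  justifiedEntry-sound {c} ok (suc zero) _ = proj₂ (Equivalence.to (T-∧ {childrenJustified c 0}) ok)
  justifiedEntry-sound ok (suc (suc _)) (s≤s ())

  base-realized : ∀ {β s} → (β , s) ∈ entries realizedStates (ctx 0) → β ≡ 0 × ∃[ i ] HasState i 0 s
  base-realized {β} {s} p∈ with Equivalence.to (T-∧ {isYes (β ≟ 0)}) (All.lookup (all⁺ baseEntry _ (proj₂ realizedStates-checked)) p∈)
  ... | β≡0 , ok with i , _ , has ← find (any⁻ (λ i → isYes (hasState? i 0 s)) (upTo (positionBound 0)) ok) =
    toWitness β≡0 , i , toWitness has

children-justified : ∀ {c s} → s ∈ entries reachableStates c → ∀ a → a ≤ 1 → T (childrenJustified c a)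
children-justified {c} s∈ = justifiedEntry-sound
  (All.lookup (all⁺ justifiedEntry _ (proj₁ realizedStates-checked)) (entries-key reachableStates c s∈))

childrenJustified-sound : ∀ {c a} → T (childrenJustified c a) → T (needsJustification c a) →
  prefixImageLength c + a ∸ 4 + 9 ≤ length (σ* c) × T (all (justified c a) (entries realizedStates (childKey c a)))
childrenJustified-sound {c} {a} ok needed with needsJustification c a
... | true = let fits , rest = Equivalence.to (T-∧ {isYes (prefixImageLength c + a ∸ 4 + 9 ≤? length (σ* c))}) ok
             in toWitness fits , rest

ctx-suc≢ctx-0 : ∀ q → ctx (suc q) ≢ ctx 0
ctx-suc≢ctx-0 q eq with () ← trans (cong padded (+-comm 3 (suc q)))
  (trans (window-occurs (suc q) 9 .letterAt 3 (s≤s (s≤s (s≤s (s≤s z≤n))))) (cong (λ c → lookupᵈ □ c 3) eq))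

needs-at : ∀ {b q k} → InBlock b q (suc k) → T (needsJustification (ctx q) (bit b))
needs-at {q = zero} (first ())
needs-at {q = suc q} (first _) with ctx (suc q) ≟ʷ ctx 0
... | yes eq = ⊥-elim (ctx-suc≢ctx-0 q eq)
... | no _ = _
needs-at {q = q} (second _ long) =
  fromWitness (subst LongBlock (trans (cong padded (+-comm 4 q)) (window-occurs q 9 .letterAt 4 (s≤s (s≤s (s≤s (s≤s (s≤s z≤n))))))) long)

inBlock-index : ∀ {b q k} → InBlock b q (suc k) → q ≤ k
inBlock-index {q = zero} _ = z≤n
inBlock-index {b} {suc q} {k} ib = +-cancelˡ-≤ 5 (suc q) k
  (≤-trans (blockPos-grows q) (≤-trans (m≤m+n _ (bit b)) (≤-reflexive (sym (inBlock-pos ib)))))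

length-≤-σ* : ∀ u → length u ≤ length (σ* u)
length-≤-σ* [] = z≤n
length-≤-σ* (s ∷ u) = subst (suc (length u) ≤_) (sym (length-++ (σ s) {σ* u})) (+-mono-≤ (length-σ-pos s) (length-≤-σ* u))

4≤prefixImageLength : ∀ q → 4 ≤ prefixImageLength (ctx q)
4≤prefixImageLength q = length-≤-σ* (take 4 (ctx q))

realized-β≤ : ∀ q {β s} → (β , s) ∈ entries realizedStates (ctx q) → β ≤ 1 → β ≤ q
realized-β≤ zero p∈ _ = ≤-reflexive (proj₁ (base-realized p∈))
realized-β≤ (suc q) _ β≤1 = ≤-trans β≤1 (s≤s z≤n)

Realizable : ℕ → Set
Realizable k = ∀ {β s} → (β , s) ∈ entries realizedStates (ctx k) → ∀ m → m + β ≡ k → ∃[ i ] HasState i m s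

realized-step : ∀ k → (∀ {q} → q < suc k → Realizable q) → Realizable (suc k)
realized-step k ih {β} {s} s∈ m m+β≡ with bb , q , ib ← inBlock-exists (suc k) = realize why
  where
  c = ctx q
  a = bit bb
  pre = prefixImageLength c
  checked : pre + a ∸ 4 + 9 ≤ length (σ* c) × T (all (justified c a) (entries realizedStates (childKey c a)))
  checked = childrenJustified-sound {c} {a} (children-justified (proj₁ (proj₂ (reachable 0 q))) a (bit≤1 bb)) (needs-at ib)
  pos : 4 + suc k ≡ blockPos q + (pre + a)
  pos = trans (inBlock-pos ib) (trans (cong (_+ a) blockPos-4+q) (+-assoc (blockPos q) pre a))
    where
    blockPos-4+q : blockPos (4 + q) ≡ blockPos q + pre
    blockPos-4+q = trans (cong blockPos (+-comm 4 q)) (blockPos-occurs 4 (window-occurs q 9) (s≤s (s≤s (s≤s (s≤s z≤n)))))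
  k≡ : suc k ≡ blockPos q + (pre + a ∸ 4)
  k≡ = +-cancelˡ-≡ 4 _ _ (trans pos (trans (cong (blockPos q +_) (sym (m∸n+n≡m (≤-trans (4≤prefixImageLength q) (m≤m+n pre a)))))
         (lemma (blockPos q) (pre + a ∸ 4))))
    where lemma : ∀ x y → x + (y + 4) ≡ 4 + (x + y)
          lemma = solve-∀
  key : ctx (suc k) ≡ childKey c a
  key = trans (cong (λ p → window p 9) k≡)
          (window-occursAt 9 (occursAt-drop (pre + a ∸ 4) (occursAt-σ* (window-occurs q 9)))
            (subst (9 ≤_) (sym (length-drop (pre + a ∸ 4) (σ* c)))
              (m+n≤o⇒m≤o∸n 9 (subst (_≤ length (σ* c)) (+-comm _ 9) (proj₁ checked)))))
  why : Justification c a β s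
  why = justified-sound (All.lookup (all⁺ (justified c a) (entries realizedStates (childKey c a)) (proj₂ checked))
                                    (subst (λ c' → (β , s) ∈ entries realizedStates c') key s∈))
  realize : Justification c a β s → ∃[ i ] HasState i m s
  realize record { β' = β' ; s' = s' ; a' = a' ; b' = b' ; parent∈ = parent∈ ; β'≤1 = β'≤1 ; guard-a = guard-a
                 ; guard-b = guard-b ; step = st ; child≡ = child≡ ; offset≡ = offset≡ }
    = let j , has = ih (s≤s (inBlock-index ib)) parent∈ (q ∸ β') m+β'≡q
          i , start = startsAt-guarded a' j (subst (Guard a') (sym (HasState.before-eq has)) guard-a)
          n , end = endsAt-guarded b' (q ∸ β') start (subst (Guard b') (sym (HasState.after-eq has)) guard-b)
      in i , subst₂ (HasState i) (n≡m has start end) child≡ (step-state has start end m+β'≡q st)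
    where
    m+β'≡q : q ∸ β' + β' ≡ q
    m+β'≡q = m∸n+n≡m (realized-β≤ q parent∈ β'≤1)
    n≡m : ∀ {j i n} → HasState j (q ∸ β') s' → StartsAt a' j i → InBlock b' (j + (q ∸ β')) (i + n) → n ≡ m
    n≡m {n = n} has start end = +-cancelʳ-≡ (β + 4) n m (begin
      n + (β + 4)                             ≡⟨ cong (_+ (β + 4)) (step-length has start end m+β'≡q st) ⟩
      blockPos q + Step.offset st + (β + 4)   ≡⟨ lemma (blockPos q) (Step.offset st) β ⟩
      blockPos q + (Step.offset st + 4 + β)   ≡⟨ cong (blockPos q +_) offset≡ ⟩
      blockPos q + (pre + a)                  ≡⟨ sym pos ⟩
      4 + suc k                               ≡⟨ cong (4 +_) (sym m+β≡) ⟩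
      4 + (m + β)                             ≡⟨ lemma′ m β ⟩
      m + (β + 4)                             ∎)
      where
      open ≡-Reasoning
      lemma : ∀ x o b → x + o + (b + 4) ≡ x + (o + 4 + b)
      lemma = solve-∀
      lemma′ : ∀ m b → 4 + (m + b) ≡ m + (b + 4)
      lemma′ = solve-∀

realized : ∀ k → Realizable k
realized = <-rec Realizable step
  where
  step : ∀ k → (∀ {q} → q < k → Realizable q) → Realizable k
  step zero _ p∈ m m+β≡0 with refl , i , has ← base-realized p∈ with refl ← trans (sym (+-identityʳ m)) m+β≡0 = i , has
  step (suc k) ih = realized-step k ih

-- Upper and lower bounds

open import Data.List.Membership.DecPropositional _≟ᵥ_ using () renaming (_∈?_ to _∈ᵥ?_)

vecOf : ℕ → ParikhVec → ParikhVec
vecOf n e = (prefixParikh (4 + n) ⊕ e) ⊖ 𝟙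

excesses : ℕ → List ParikhVec
excesses n = deduplicate _≟ᵥ_ (map excessOf (entries reachableStates (ctx n)))

parikh≡vecOf : ∀ {i n s} → HasState i n s → parikh (factor i n) ≡ vecOf n (excessOf s)
parikh≡vecOf {i} {n} has = trans (sym (⊕-⊖ (parikh (factor i n)) 𝟙)) (cong (_⊖ 𝟙) (HasState.excess-eq has))

excess-exists : ∀ i n → ∃[ e ] (e ∈ excesses n × parikh (factor i n) ≡ vecOf n e)
excess-exists i n =
  let s , s∈ , has = reachable i n
  in excessOf s , ∈-deduplicate⁺ _≟ᵥ_ (∈-map⁺ excessOf s∈) , parikh≡vecOf has

sample : ℕ → List ParikhVec
sample n = map (λ i → parikh (factor i n)) (upTo (positionBound n))

parikhVectors : ℕ → List ParikhVec
parikhVectors n = deduplicate _≟ᵥ_ (filter (_∈ᵥ? sample n) (map (vecOf n) (excesses n)))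

parikhVectors-complete : ∀ n i → parikh (factor i n) ∈ parikhVectors n
parikhVectors-complete n i =
  let e , e∈ , p≡ = excess-exists i n
      i' , i'< , alike = alike-below n i
      in-sample = subst (_∈ sample n) (Alike.parikh≡ alike) (∈-map⁺ (λ i → parikh (factor i n)) (∈-upTo⁺ i'<))
  in ∈-deduplicate⁺ _≟ᵥ_ (∈-filter⁺ (_∈ᵥ? sample n) (subst (_∈ map (vecOf n) (excesses n)) (sym p≡) (∈-map⁺ (vecOf n) e∈))
       in-sample)

parikhVectors-sound : ∀ n v → v ∈ parikhVectors n → IsParikhOfFactor n v
parikhVectors-sound n v v∈ =
  let i , _ , v≡ = ∈-map⁻ (λ i → parikh (factor i n))
                     (proj₂ (∈-filter⁻ (_∈ᵥ? sample n) {xs = map (vecOf n) (excesses n)} (∈-deduplicate⁻ _≟ᵥ_ _ v∈)))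
  in i , sym v≡

opaque
  fewExcesses : List Sym × List State → Bool
  fewExcesses (_ , ss) = isYes (length (deduplicate _≟ᵥ_ (map excessOf ss)) ≤? 7)

opaque
  unfolding fewExcesses

  reachableStates-few : T (all fewExcesses reachableStates)
  reachableStates-few = _

  fewExcesses-sound : ∀ {c ss} → T (fewExcesses (c , ss)) → length (deduplicate _≟ᵥ_ (map excessOf ss)) ≤ 7
  fewExcesses-sound = toWitness

length-excesses : ∀ n → length (excesses n) ≤ 7
length-excesses n =
  let _ , s∈ , _ = reachable 0 n
  in fewExcesses-sound (All.lookup (all⁺ fewExcesses reachableStates reachableStates-few) (entries-key reachableStates (ctx n) s∈))

parikhVectors-unique : ∀ n → Unique (parikhVectors n)
parikhVectors-unique n = deduplicate-! _≟ᵥ_ _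

length-parikhVectors : ∀ n → length (parikhVectors n) ≤ 7
length-parikhVectors n = begin
  length (parikhVectors n)                                        ≤⟨ length-deduplicate _≟ᵥ_ (filter (_∈ᵥ? sample n) (map (vecOf n) (excesses n))) ⟩
  length (filter (_∈ᵥ? sample n) (map (vecOf n) (excesses n)))   ≤⟨ length-filter (_∈ᵥ? sample n) (map (vecOf n) (excesses n)) ⟩
  length (map (vecOf n) (excesses n))                             ≡⟨ length-map (vecOf n) (excesses n) ⟩
  length (excesses n)                                             ≤⟨ length-excesses n ⟩
  7                                                               ∎
  where open ≤-Reasoning

zeroExcesses : List (ℕ × State) → List ParikhVec
zeroExcesses ps = deduplicate _≟ᵥ_ (map (excessOf ∘ proj₂) (filter (λ p → proj₁ p ≟ 0) ps))

zeroExcess-realized : ∀ n ps → (∀ {s} → (0 , s) ∈ ps → ∃[ i ] HasState i n s) →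
                      ∀ {e} → e ∈ zeroExcesses ps → ∃[ i ] parikh (factor i n) ⊕ 𝟙 ≡ prefixParikh (4 + n) ⊕ e
zeroExcess-realized n ps realizes e∈ =
  let (β , s) , p∈ , e≡ = ∈-map⁻ (excessOf ∘ proj₂) (∈-deduplicate⁻ _≟ᵥ_ _ e∈)
      p∈ps , β≡0 = ∈-filter⁻ (λ p → proj₁ p ≟ 0) {xs = ps} p∈
      i , has = realizes (subst (λ β → (β , s) ∈ ps) β≡0 p∈ps)
  in i , trans (HasState.excess-eq has) (cong (prefixParikh (4 + n) ⊕_) (sym e≡))

realizedExcesses : List Sym → List ParikhVec
realizedExcesses c = zeroExcesses (entries realizedStates c)

realizedExcesses-unique : ∀ c → Unique (realizedExcesses c)
realizedExcesses-unique c = deduplicate-! _≟ᵥ_ _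

opaque
  manyRealized : List Sym × List State → Bool
  manyRealized (c , _) = isYes (c ≟ʷ ctx 0) ∨ isYes (3 ≤? length (realizedExcesses c))

opaque
  unfolding manyRealized

  reachableStates-many : T (all manyRealized reachableStates)
  reachableStates-many = _

  manyRealized-sound : ∀ {c ss} → T (manyRealized (c , ss)) → c ≢ ctx 0 → 3 ≤ length (realizedExcesses c)
  manyRealized-sound {c} ok c≢ctx0 =
    [ (λ ctx0 → ⊥-elim (c≢ctx0 (toWitness ctx0))) , toWitness ]′ (Equivalence.to (T-∨ {isYes (c ≟ʷ ctx 0)}) ok)

length-realizedExcesses : ∀ n → 3 ≤ length (realizedExcesses (ctx (suc n)))
length-realizedExcesses n =
  let _ , s∈ , _ = reachable 0 (suc n)
  in manyRealized-sound (All.lookup (all⁺ manyRealized reachableStates reachableStates-many) (entries-key reachableStates _ s∈))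
       (ctx-suc≢ctx-0 n)

realizedExcess-realized : ∀ n {e} → e ∈ realizedExcesses (ctx n) → ∃[ i ] parikh (factor i n) ⊕ 𝟙 ≡ prefixParikh (4 + n) ⊕ e
realizedExcess-realized n =
  zeroExcess-realized n (entries realizedStates (ctx n)) (λ p∈ → realized n p∈ n (+-identityʳ n))

three-distinct : ∀ {A : Set} {xs : List A} → Unique xs → 3 ≤ length xs →
                 ∃[ x ] ∃[ y ] ∃[ z ] (x ∈ xs × y ∈ xs × z ∈ xs × x ≢ y × x ≢ z × y ≢ z)
three-distinct ((x≢y ∷ x≢z ∷ _) ∷ (y≢z ∷ _) ∷ _) (s≤s (s≤s (s≤s z≤n))) =
  _ , _ , _ , here refl , there (here refl) , there (there (here refl)) , x≢y , x≢z , y≢z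

two≤length : ∀ {A : Set} {x y : A} {xs} → x ∈ xs → y ∈ xs → x ≢ y → 2 ≤ length xs
two≤length (here refl) (here refl) x≢y = ⊥-elim (x≢y refl)
two≤length (here refl) (there {xs = _ ∷ _} _) _ = s≤s (s≤s z≤n)
two≤length (there {xs = _ ∷ _} _) _ _ = s≤s (s≤s z≤n)

three≤length : ∀ {A : Set} {x y z : A} {xs} → x ∈ xs → y ∈ xs → z ∈ xs → x ≢ y → x ≢ z → y ≢ z → 3 ≤ length xs
three≤length (here refl) (here refl) _ x≢y _ _ = ⊥-elim (x≢y refl)
three≤length (here refl) _ (here refl) _ x≢z _ = ⊥-elim (x≢z refl)
three≤length (here refl) (there y∈) (there z∈) _ _ y≢z = s≤s (two≤length y∈ z∈ y≢z)
three≤length (there x∈) (here refl) (here refl) _ _ y≢z = ⊥-elim (y≢z refl)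
three≤length (there x∈) (here refl) (there z∈) _ x≢z _ = s≤s (two≤length x∈ z∈ x≢z)
three≤length (there x∈) (there y∈) (here refl) x≢y _ _ = s≤s (two≤length x∈ y∈ x≢y)
three≤length (there x∈) (there y∈) (there z∈) x≢y x≢z y≢z = m≤n⇒m≤1+n (three≤length x∈ y∈ z∈ x≢y x≢z y≢z)

distinct-parikh : ∀ {n i i' e e'} → parikh (factor i n) ⊕ 𝟙 ≡ prefixParikh (4 + n) ⊕ e →
                  parikh (factor i' n) ⊕ 𝟙 ≡ prefixParikh (4 + n) ⊕ e' → e ≢ e' →
                  parikh (factor i n) ≢ parikh (factor i' n)
distinct-parikh {n} h h' e≢e' p≡p' = e≢e' (⊕-cancelˡ _ _ (prefixParikh (4 + n)) (trans (sym h) (trans (cong (_⊕ 𝟙) p≡p') h')))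

3≤length-parikhVectors : ∀ n (E : List ParikhVec) → Unique E → 3 ≤ length E →
  (∀ {e} → e ∈ E → ∃[ i ] parikh (factor i n) ⊕ 𝟙 ≡ prefixParikh (4 + n) ⊕ e) → 3 ≤ length (parikhVectors n)
3≤length-parikhVectors n E unique 3≤ realizes =
  let e₁ , e₂ , e₃ , e₁∈ , e₂∈ , e₃∈ , e₁≢e₂ , e₁≢e₃ , e₂≢e₃ = three-distinct unique 3≤
      i₁ , h₁ = realizes e₁∈
      i₂ , h₂ = realizes e₂∈
      i₃ , h₃ = realizes e₃∈
  in three≤length (parikhVectors-complete n i₁) (parikhVectors-complete n i₂) (parikhVectors-complete n i₃)
       (distinct-parikh {n} {i₁} {i₂} h₁ h₂ e₁≢e₂) (distinct-parikh {n} {i₁} {i₃} h₁ h₃ e₁≢e₃) (distinct-parikh {n} {i₂} {i₃} h₂ h₃ e₂≢e₃)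

abelianComplexity-bounded : ∀ n → 1 ≤ n → ∃[ m ] (AbelianComplexity n m × 3 ≤ m × m ≤ 7)
abelianComplexity-bounded (suc n) _ =
  length (parikhVectors (suc n)) ,
  (parikhVectors (suc n) , parikhVectors-unique (suc n) , refl , parikhVectors-sound (suc n) , parikhVectors-complete (suc n)) ,
  3≤length-parikhVectors (suc n) (realizedExcesses (ctx (suc n))) (realizedExcesses-unique (ctx (suc n)))
    (length-realizedExcesses n) (realizedExcess-realized (suc n)) ,
  length-parikhVectors (suc n)

-- The attained values

parikh-++ : ∀ u v → parikh (u ++ v) ≡ parikh u ⊕ parikh v
parikh-++ u v =
  trans (parikh≡parikhˢ (u ++ v))
    (trans (cong parikhˢ (map-++ just u v))
      (trans (parikhˢ-++ (map just u) (map just v)) (sym (cong₂ _⊕_ (parikh≡parikhˢ u) (parikh≡parikhˢ v)))))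

prefixParikh-τ^ : ∀ K k → k ≤ length (τ^ K) → prefixParikh (4 + k) ≡ parikh (take k (τ^ K))
prefixParikh-τ^ K zero _ = refl
prefixParikh-τ^ K (suc k) k< =
  begin
    prefixParikh (4 + k) ⊕ unit (just (t k))
      ≡⟨ cong₂ (λ v x → v ⊕ unit (just x)) (prefixParikh-τ^ K k (<⇒≤ k<)) (t-τ^ K k<) ⟩
    parikh (take k w) ⊕ unit (just x)
      ≡⟨ cong (parikh (take k w) ⊕_) (sym (trans (parikh-∷ x []) (⊕-identityʳ _))) ⟩
    parikh (take k w) ⊕ parikh (x ∷ [])
      ≡⟨ sym (parikh-++ (take k w) (x ∷ [])) ⟩
    parikh (take k w ++ x ∷ [])
      ≡⟨ cong parikh (sym (take-suc-lookupᵈ l0 w k<)) ⟩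
    parikh (take (suc k) w) ∎
  where
  open ≡-Reasoning
  w = τ^ K
  x = lookupᵈ l0 w k

parikh-factor-τ^ : ∀ K i n → i + n ≤ length (τ^ K) →
                   parikh (factor i n) ≡ parikh (take (i + n) (τ^ K)) ⊖ parikh (take i (τ^ K))
parikh-factor-τ^ K i n i+n≤ =
  trans (sym (⊕-⊖ (parikh (factor i n)) (parikh (take i (τ^ K)))))
    (cong (_⊖ parikh (take i (τ^ K)))
      (begin
        parikh (factor i n) ⊕ parikh (take i (τ^ K))       ≡⟨ ⊕-comm (parikh (factor i n)) _ ⟩
        parikh (take i (τ^ K)) ⊕ parikh (factor i n)       ≡⟨ cong (_⊕ parikh (factor i n)) (sym (prefixParikh-τ^ K i (m+n≤o⇒m≤o i i+n≤))) ⟩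
        prefixParikh (4 + i) ⊕ parikh (factor i n)         ≡⟨ sym (prefixParikh-factor i n) ⟩
        prefixParikh (4 + (i + n))                         ≡⟨ prefixParikh-τ^ K (i + n) i+n≤ ⟩
        parikh (take (i + n) (τ^ K))                       ∎))
  where open ≡-Reasoning

longPrefix : List Letter
longPrefix = τ^ 17

length-longPrefix : length longPrefix ≡ 35890
length-longPrefix = refl

factorParikh : ℕ → ℕ → ParikhVec
factorParikh n i = parikh (take (i + n) longPrefix) ⊖ parikh (take i longPrefix)

vecFast : ℕ → ParikhVec → ParikhVec
vecFast n e = (parikh (take n longPrefix) ⊕ e) ⊖ 𝟙

Witness : ℕ → ParikhVec → ℕ → Set
Witness n e i = i + n ≤ 35890 × factorParikh n i ≡ vecFast n e

witness? : ∀ n e i → Dec (Witness n e i)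
witness? n e i = (i + n ≤? 35890) ×-dec (factorParikh n i ≟ᵥ vecFast n e)

pointwise-∈ : ∀ {A B : Set} {R : A → B → Set} {xs ys x} → Pointwise R xs ys → x ∈ xs → ∃[ y ] R x y
pointwise-∈ (r ∷ _) (here refl) = _ , r
pointwise-∈ (_ ∷ rs) (there x∈) = pointwise-∈ rs x∈

witnessed-sound : ∀ n E is → Pointwise (Witness n) E is →
                  ∀ v → v ∈ deduplicate _≟ᵥ_ (map (vecFast n) E) → IsParikhOfFactor n v
witnessed-sound n E is witnessed v v∈ =
  let e , e∈ , v≡ = ∈-map⁻ (vecFast n) (∈-deduplicate⁻ _≟ᵥ_ (map (vecFast n) E) v∈)
      i , i+n≤ , i-witness = pointwise-∈ witnessed e∈
  in i , trans (parikh-factor-τ^ 17 i n (subst (i + n ≤_) (sym length-longPrefix) i+n≤)) (trans i-witness (sym v≡))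

AttainedCheck : ℕ → List ℕ → Set
AttainedCheck n is = True (n ≤? 35890) × True (Pointwise.decidable (witness? n) (excesses n) is)

attains : ∀ n is → AttainedCheck n is → AbelianComplexity n (length (deduplicate _≟ᵥ_ (map (vecFast n) (excesses n))))
attains n is (n≤ , witnessed) =
  vectors , deduplicate-! _≟ᵥ_ _ , refl , witnessed-sound n (excesses n) is (toWitness witnessed) , complete
  where
  vectors = deduplicate _≟ᵥ_ (map (vecFast n) (excesses n))
  complete : ∀ i → parikh (factor i n) ∈ vectors
  complete i =
    let e , e∈ , p≡ = excess-exists i n
    in subst (_∈ vectors) (sym (trans p≡ (cong (λ v → (v ⊕ e) ⊖ 𝟙) (prefixParikh-τ^ 17 n (subst (n ≤_) (sym length-longPrefix) (toWitness n≤))))))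
         (∈-deduplicate⁺ _≟ᵥ_ (∈-map⁺ (vecFast n) e∈))

-- Each witness list gives, in the order of excesses n, a position realizing each candidate.
abelianComplexity-attains : ∀ m → 3 ≤ m → m ≤ 7 → ∃[ n ] (1 ≤ n × AbelianComplexity n m)
abelianComplexity-attains 1 (s≤s ()) _
abelianComplexity-attains 2 (s≤s (s≤s ())) _
abelianComplexity-attains 3 _ _ = 1 , s≤s z≤n , attains 1 (3 ∷ 1 ∷ 0 ∷ []) _
abelianComplexity-attains 4 _ _ = 3 , s≤s z≤n , attains 3 (1 ∷ 12 ∷ 0 ∷ 2 ∷ []) _
abelianComplexity-attains 5 _ _ = 30 , s≤s z≤n , attains 30 (147 ∷ 0 ∷ 29 ∷ 2 ∷ 4 ∷ []) _
abelianComplexity-attains 6 _ _ = 2115 , s≤s z≤n , attains 2115 (54 ∷ 8 ∷ 0 ∷ 4 ∷ 2126 ∷ 10525 ∷ []) _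
abelianComplexity-attains 7 _ _ = 3914 , s≤s z≤n , attains 3914 (326 ∷ 19335 ∷ 327 ∷ 0 ∷ 3899 ∷ 374 ∷ 626 ∷ []) _
abelianComplexity-attains (suc (suc (suc (suc (suc (suc (suc (suc _)))))))) _ (s≤s (s≤s (s≤s (s≤s (s≤s (s≤s (s≤s ())))))))

theorem3 : (∀ n → 1 ≤ n → ∃[ m ] (AbelianComplexity n m × 3 ≤ m × m ≤ 7))
    × (∀ m → 3 ≤ m → m ≤ 7 → ∃[ n ] (1 ≤ n × AbelianComplexity n m))
theorem3 = abelianComplexity-bounded , abelianComplexity-attains
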